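{- Let $n\ge 2$ and let $\pi$ be an avoider of $[n]$ whose first letter is not $n$ and in which $n$ appears to the left of $n-1$. Then $\mathrm{lmax}\,\psi(\pi)=\mathrm{lmax}\,\pi$, $\mathrm{rmax}\,\psi(\pi)=\mathrm{rmax}\,\pi$, $\mathrm{asc}\,\psi(\pi)=\mathrm{asc}\,\pi$, $\mathrm{ldr}\,\psi(\pi)=\mathrm{ldr}\,\pi$, $\mathrm{lir}\,\psi(\pi)=\mathrm{lir}\,\pi$, and $\mathrm{lmin}\,\psi(\pi)=\mathrm{lmin}\,\pi+1$.
   Context: A permutation $\pi=a_1\cdots a_n$ of $[n]$ is an avoider if there are no $i<j<k<\ell$ with $a_j<a_\ell<a_i<a_k$ (3-1-4-2) and no $i<j<k$ with $j+1<k$ and $a_{j+1}<a_i<a_k<a_j$ (dashed pattern 2-41-3). Statistics: $\mathrm{asc}$ = number of $j$ with $a_j<a_{j+1}$; $\mathrm{lmax}$ ($\mathrm{lmin}$) = number of letters larger (smaller) than all letters to their left; $\mathrm{rmax}$ = number of letters larger than all letters to their right; $\mathrm{ldr}$ = largest $i$ with $a_1>a_2>\dots>a_i$; $\mathrm{lir}$ = largest $i$ with $a_1<\dots<a_i$. For words, $\alpha\prec\beta$ means every letter of $\alpha$ is less than every letter of $\beta$ (vacuous if one is empty). For $V=\{v_1<\dots<v_m\}$ and a permutation $\rho$ of $[m]$, $\mathrm{st}_V^{ -1}(\rho)$ replaces each letter $j$ by $v_j$; $\mathrm{st}(w)$ is the permutation order-isomorphic to the word $w$. The map $\psi$: write $\pi=\sigma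 n\tau$; let $\sigma_1\prec\dots\prec\sigma_k$ be the subsequences of $\sigma$ formed by the maximal blocks of consecutive integers among the letters of $\sigma$, with $\sigma_0=\sigma_{k+1}$ empty; let $w_i$ ($0\le i\le k$) be the subsequence of letters $x$ of $\tau$ with $\sigma_i\prec x\prec\sigma_{i+1}$; for $1\le i\le k$ write $w_i=u_i\hat0_iv_i$ with $\hat0_i=\min w_i$, let $m_i=\#\{x\in v_i: x\prec u_i\}$, $L_i=\{x+m_i+1:x\in\sigma_i\}$, $L=\bigcup_iL_i$, $R=[n-1]\setminus L$; then $\psi(\pi)=\mathrm{st}_L^{ -1}(\mathrm{st}(\sigma))\,n\,\mathrm{st}_R^{ -1}(\mathrm{st}(\tau))$. -}

module Defs where

open import Data.Bool using (Bool; true; false; if_then_else_; not; _∧_)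
open import Data.Nat using (ℕ; zero; suc; _+_; _∸_; _<ᵇ_; _≡ᵇ_)
open import Data.List using (List; []; _∷_; _++_; map; length; reverse; concat; applyUpTo; lookup; head; drop; zip; filterᵇ; takeWhileᵇ; dropWhileᵇ)
open import Data.Fin using (Fin; toℕ) renaming (_<_ to _<ᶠ_)
open import Data.Maybe using (Maybe; just; nothing)
open import Data.Product using (_×_; _,_; proj₁; proj₂)
open import Data.Empty using (⊥)
open import Relation.Nullary using (¬_)
open import Relation.Binary.PropositionalEquality using (_≡_)
open import Data.List.Relation.Binary.Permutation.Propositional using (_↭_)
open import Data.Bool.ListAction using (all; any)

range : ℕ → List ℕ
range n = applyUpTo suc n

IsPerm : ℕ → List ℕ → Set
IsPerm n π = π ↭ range n

-- a_i with 0-based positions  (position p ↦ letter a_{p+1})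
infixl 9 _!_
_!_ : (π : List ℕ) → Fin (length π) → ℕ
π ! i = lookup π i

Avoids3142 : List ℕ → Set
Avoids3142 π = ∀ (i j k l : Fin (length π)) → i <ᶠ j → j <ᶠ k → k <ᶠ l →
  ¬ ((π ! j Data.Nat.< π ! l) × (π ! l Data.Nat.< π ! i) × (π ! i Data.Nat.< π ! k))

Avoids2-41-3 : List ℕ → Set
Avoids2-41-3 π = ∀ (i j j' k : Fin (length π)) → i <ᶠ j → toℕ j' ≡ suc (toℕ j) → j' <ᶠ k →
  ¬ ((π ! j' Data.Nat.< π ! i) × (π ! i Data.Nat.< π ! k) × (π ! k Data.Nat.< π ! j))

Avoider : List ℕ → Set
Avoider π = Avoids3142 π × Avoids2-41-3 π

b2n : Bool → ℕ
b2n true  = 1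
b2n false = 0

asc : List ℕ → ℕ
asc (x ∷ y ∷ r) = b2n (x <ᵇ y) + asc (y ∷ r)
asc _           = 0

rmax : List ℕ → ℕ
rmax []      = 0
rmax (x ∷ r) = b2n (all (λ y → y <ᵇ x) r) + rmax r

rmin : List ℕ → ℕ
rmin []      = 0
rmin (x ∷ r) = b2n (all (λ y → x <ᵇ y) r) + rmin r

lmax : List ℕ → ℕ
lmax π = rmax (reverse π)

lmin : List ℕ → ℕ
lmin π = rmin (reverse π)

ldr : List ℕ → ℕ
ldr []          = 0
ldr (x ∷ [])    = 1
ldr (x ∷ y ∷ r) = if y <ᵇ x then suc (ldr (y ∷ r)) else 1

lir : List ℕ → ℕ
lir []          = 0
lir (x ∷ [])    = 1
lir (x ∷ y ∷ r) = if x <ᵇ y then suc (lir (y ∷ r)) else 1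

_≺ᵇ_ : List ℕ → List ℕ → Bool
α ≺ᵇ β = all (λ a → all (λ b → a <ᵇ b) β) α

-- st(w): the permutation order-isomorphic to w (w has distinct letters)
st : List ℕ → List ℕ
st w = map (λ x → suc (length (filterᵇ (λ y → y <ᵇ x) w))) w

-- j-th entry (1-based) of a list, 0 if out of range
nth : List ℕ → ℕ → ℕ
nth []      _             = 0
nth (v ∷ _) 1             = v
nth (_ ∷ vs) (suc (suc j)) = nth vs (suc j)
nth (_ ∷ _) zero          = 0

-- st_V^{-1}(ρ), V given as its increasing enumeration v₁ < ⋯ < v_m
stInv : List ℕ → List ℕ → List ℕ
stInv V ρ = map (nth V) ρ

insert : ℕ → List ℕ → List ℕ
insert x []       = x ∷ []
insert x (y ∷ ys) = if y <ᵇ x then y ∷ insert x ys else x ∷ y ∷ ys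

sort : List ℕ → List ℕ
sort []       = []
sort (x ∷ xs) = insert x (sort xs)

_∈ᵇ_ : ℕ → List ℕ → Bool
x ∈ᵇ xs = any (λ y → x ≡ᵇ y) xs

-- maximal blocks of consecutive integers of an increasingly sorted list
runs : List ℕ → List (List ℕ)
runs [] = []
runs (x ∷ xs) with runs xs
... | (y ∷ b) ∷ bs = if suc x ≡ᵇ y then (x ∷ y ∷ b) ∷ bs else (x ∷ []) ∷ (y ∷ b) ∷ bs
... | other        = (x ∷ []) ∷ other

minimum : List ℕ → Maybe ℕ
minimum [] = nothing
minimum (x ∷ xs) with minimum xs
... | nothing = just x
... | just m  = just (if x <ᵇ m then x else m)

-- w = u 0̂ v with 0̂ = min w; returns (u , v)  (both empty if w is empty)
splitMin : List ℕ → List ℕ × List ℕ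
splitMin w with minimum w
... | nothing = [] , []
... | just m  = takeWhileᵇ (λ x → not (x ≡ᵇ m)) w
              , drop 1 (dropWhileᵇ (λ x → not (x ≡ᵇ m)) w)

module Psi (n : ℕ) (π : List ℕ) where
  σ : List ℕ
  σ = takeWhileᵇ (λ x → not (x ≡ᵇ n)) π

  τ : List ℕ
  τ = drop 1 (dropWhileᵇ (λ x → not (x ≡ᵇ n)) π)

  blocks : List (List ℕ)
  blocks = runs (sort σ)

  -- pairs (σ_i , σ_{i+1}) for 1 ≤ i ≤ k, with σ_{k+1} empty
  blockPairs : List (List ℕ × List ℕ)
  blockPairs = zip blocks (drop 1 blocks ++ ([] ∷ []))

  w : List ℕ → List ℕ → List ℕ
  w σi σi+1 = filterᵇ (λ x → (σi ≺ᵇ (x ∷ [])) ∧ ((x ∷ []) ≺ᵇ σi+1)) τ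

  mᵢ : List ℕ → List ℕ → ℕ
  mᵢ σi σi+1 = let uv = splitMin (w σi σi+1) in
    length (filterᵇ (λ x → (x ∷ []) ≺ᵇ proj₁ uv) (proj₂ uv))

  Lᵢ : List ℕ × List ℕ → List ℕ
  Lᵢ (σi , σi+1) = map (λ x → x + mᵢ σi σi+1 + 1) σi

  L : List ℕ
  L = sort (concat (map Lᵢ blockPairs))

  R : List ℕ
  R = filterᵇ (λ y → not (y ∈ᵇ L)) (range (n ∸ 1))

  ψ : List ℕ
  ψ = stInv L (st σ) ++ n ∷ stInv R (st τ)

ψ : ℕ → List ℕ → List ℕ
ψ n π = Psi.ψ n π

module Submission where

-- Write π = σ n τ. Then ψ π = f σ · n · g τ, where f = st_L⁻¹ ∘ st and g = st_R⁻¹ ∘ st preserve the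
-- relative order of the letters of σ and of τ and stay below n. As n is the maximum, asc, ldr and lir
-- (which compare adjacent letters only), rmax and lmax therefore agree on π and ψ π.
-- The left-to-right minima of σ n τ are those of σ together with those letters of τ that are
-- left-to-right minima of τ below c = min σ. In ψ π the threshold becomes min L = c + m₁ + 1, which the
-- image of x ∈ τ stays below exactly when fewer than c + m₁ letters of τ lie below x.
-- Let z = 0̂₁ = min w₁ and τ = τ₁ z τ₂. A letter of τ₁ below c would form a 2-41-3
-- with the last letter of σ₁ and z, and the letters 1, …, c - 1, z and those of v₁ below u₁ all lie
-- below every letter of τ₁. So no letter of τ₁ counts on either side, z counts only in ψ π, and
-- the letters of τ₂ count alike: lmin grows by exactly one.

open import Data.Bool using (Bool; true; false; if_then_else_; not; _∧_; T?)
open import Data.Bool.ListAction using (all)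
open import Data.Bool.Properties using (∧-identityʳ; ∧-zeroʳ; ∧-comm; T-≡; ¬-not; not-¬; not-injective)
open import Data.Empty using (⊥; ⊥-elim)
open import Data.Fin using (Fin; toℕ; zero; suc) renaming (_<_ to _<ᶠ_)
import Data.Fin as Fin
open import Data.List
  using (List; []; _∷_; _++_; [_]; map; length; reverse; concat; applyUpTo; drop; zip; head;
         filterᵇ; takeWhileᵇ; dropWhileᵇ)
open import Data.List.Properties
  using (length-++; length-drop; length-filter; ++-assoc; ++-identityʳ; map-++; map-∘; map-cong;
         reverse-++; reverse-map; reverse-involutive; unfold-reverse; filter-++; filter-accept)
open import Data.List.Membership.Propositional using (_∈_; _∉_)
open import Data.List.Membership.Propositional.Properties
  using (∈-++⁺ˡ; ∈-++⁺ʳ; ∈-++⁻; ∈-∃++; ∈-insert; ∈-lookup; ∈-map⁺; ∈-map⁻; ∈-filter⁺; ∈-filter⁻)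
open import Data.List.Relation.Binary.Permutation.Propositional using (↭-sym; ↭⇒↭ₛ)
open import Data.List.Relation.Binary.Permutation.Propositional.Properties using (∈-resp-↭; ↭-length)
open import Data.List.Relation.Unary.All as All using (All; []; _∷_)
open import Data.List.Relation.Unary.All.Properties using () renaming (map⁺ to All-map⁺)
open import Data.List.Relation.Unary.AllPairs as AP using (AllPairs; []; _∷_)
import Data.List.Relation.Unary.AllPairs.Properties as APP
open import Data.List.Relation.Unary.Any using (here; there)
open import Data.List.Relation.Unary.Any.Properties using (reverse⁻)
open import Data.List.Relation.Unary.Unique.Propositional using (Unique)
import Data.List.Relation.Unary.Unique.Propositional.Properties as UP
open import Data.Maybe using (just; nothing)
open import Data.Nat
open import Data.Nat.Properties
open import Data.Nat.Tactic.RingSolver using (solve-∀)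
open import Data.Product using (Σ-syntax; _×_; _,_; proj₁; proj₂; map₂)
open import Data.Sum using (_⊎_; inj₁; inj₂)
open import Data.Unit using (⊤; tt)
open import Function.Base using (_∘_; id)
open import Function.Bundles using (Equivalence)
open import Relation.Binary.Definitions using (tri<; tri≈; tri>)
open import Relation.Binary.PropositionalEquality hiding ([_])
open import Data.List.Relation.Binary.Permutation.Setoid.Properties (setoid ℕ) using (Unique-resp-↭)
open import Relation.Nullary using (¬_; yes; no)

open import Defs

Increasing : List ℕ → Set
Increasing = AllPairs _<_

<ᵇ≡true : ∀ {m n} → m < n → (m <ᵇ n) ≡ true
<ᵇ≡true m<n = Equivalence.to T-≡ (<⇒<ᵇ m<n)

<ᵇ≡true⇒< : ∀ {m n} → (m <ᵇ n) ≡ true → m < n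
<ᵇ≡true⇒< {m} {n} e = <ᵇ⇒< m n (Equivalence.from T-≡ e)

<ᵇ≡false : ∀ {m n} → m ≮ n → (m <ᵇ n) ≡ false
<ᵇ≡false {m} {n} m≮n = ¬-not (m≮n ∘ <ᵇ≡true⇒<)

<ᵇ≡false⇒≥ : ∀ {m n} → (m <ᵇ n) ≡ false → n ≤ m
<ᵇ≡false⇒≥ e = ≮⇒≥ (λ m<n → not-¬ e (<ᵇ≡true m<n))

<ᵇ-irrefl : ∀ m → (m <ᵇ m) ≡ false
<ᵇ-irrefl m = <ᵇ≡false {m} (<-irrefl refl)

≡ᵇ≡true : ∀ {m n} → m ≡ n → (m ≡ᵇ n) ≡ true
≡ᵇ≡true {m} {n} m≡n = Equivalence.to T-≡ (≡⇒≡ᵇ m n m≡n)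

≡ᵇ≡true⇒≡ : ∀ {m n} → (m ≡ᵇ n) ≡ true → m ≡ n
≡ᵇ≡true⇒≡ {m} {n} e = ≡ᵇ⇒≡ m n (Equivalence.from T-≡ e)

∧≡true⁻ : ∀ {a b} → (a ∧ b) ≡ true → a ≡ true × b ≡ true
∧≡true⁻ {true} {true} _ = refl , refl

∧≡true⁺ : ∀ {a b} → a ≡ true → b ≡ true → (a ∧ b) ≡ true
∧≡true⁺ refl refl = refl

∈ᵇ≡true⇒∈ : ∀ {y} L → (y ∈ᵇ L) ≡ true → y ∈ L
∈ᵇ≡true⇒∈ {y} (z ∷ L) e with y ≡ᵇ z in e2
... | true = here (≡ᵇ≡true⇒≡ e2)
... | false = there (∈ᵇ≡true⇒∈ L e)

∈⇒∈ᵇ≡true : ∀ {y} L → y ∈ L → (y ∈ᵇ L) ≡ true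
∈⇒∈ᵇ≡true {y} (z ∷ L) (here refl) rewrite ≡ᵇ≡true {y} {y} refl = refl
∈⇒∈ᵇ≡true {y} (z ∷ L) (there m) with y ≡ᵇ z
... | true = refl
... | false = ∈⇒∈ᵇ≡true L m

∉⇒∈ᵇ≡false : ∀ {y} (l : List ℕ) → y ∉ l → (y ∈ᵇ l) ≡ false
∉⇒∈ᵇ≡false {y} l nm with y ∈ᵇ l in e
... | false = refl
... | true = ⊥-elim (nm (∈ᵇ≡true⇒∈ l e))

filterᵇ-accept : ∀ (p : ℕ → Bool) x xs → p x ≡ true → filterᵇ p (x ∷ xs) ≡ x ∷ filterᵇ p xs
filterᵇ-accept p x xs e = filter-accept (T? ∘ p) (Equivalence.from T-≡ e)

∈-filterᵇ⁻ : ∀ (p : ℕ → Bool) {x} xs → x ∈ filterᵇ p xs → x ∈ xs × p x ≡ true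
∈-filterᵇ⁻ p xs m = map₂ (Equivalence.to T-≡) (∈-filter⁻ (T? ∘ p) m)

∈-filterᵇ⁺ : ∀ (p : ℕ → Bool) {x} xs → x ∈ xs → p x ≡ true → x ∈ filterᵇ p xs
∈-filterᵇ⁺ p xs m e = ∈-filter⁺ (T? ∘ p) m (Equivalence.from T-≡ e)

filterᵇ-unique : ∀ (p : ℕ → Bool) {l : List ℕ} → Unique l → Unique (filterᵇ p l)
filterᵇ-unique p u = UP.filter⁺ (λ x → T? (p x)) u

length-filterᵇ : ∀ (p : ℕ → Bool) xs → length (filterᵇ p xs) ≤ length xs
length-filterᵇ p = length-filter (T? ∘ p)

length-filterᵇ-none : ∀ (p : ℕ → Bool) (l : List ℕ) → (∀ {y} → y ∈ l → p y ≡ false) →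
  length (filterᵇ p l) ≡ 0
length-filterᵇ-none p [] h = refl
length-filterᵇ-none p (y ∷ l) h rewrite h (here refl) = length-filterᵇ-none p l (λ m → h (there m))

length-filterᵇ-partition : ∀ (p : ℕ → Bool) xs →
  length (filterᵇ p xs) + length (filterᵇ (λ y → not (p y)) xs) ≡ length xs
length-filterᵇ-partition p [] = refl
length-filterᵇ-partition p (x ∷ xs) with p x
... | true = cong suc (length-filterᵇ-partition p xs)
... | false = trans (+-suc _ _) (cong suc (length-filterᵇ-partition p xs))

length-filterᵇ-< : ∀ (p : ℕ → Bool) {x} w → x ∈ w → p x ≡ false → length (filterᵇ p w) < length w
length-filterᵇ-< p (y ∷ w) (here refl) e rewrite e = s≤s (length-filterᵇ p w)
length-filterᵇ-< p (y ∷ w) (there m) e with p y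
... | true = s≤s (length-filterᵇ-< p w m e)
... | false = m≤n⇒m≤1+n (length-filterᵇ-< p w m e)

length-filterᵇ-mono : ∀ (p q : ℕ → Bool) w → (∀ z → p z ≡ true → q z ≡ true) →
  length (filterᵇ p w) ≤ length (filterᵇ q w)
length-filterᵇ-mono p q [] f = z≤n
length-filterᵇ-mono p q (y ∷ w) f with p y in e1 | q y in e2
... | true | true = s≤s (length-filterᵇ-mono p q w f)
... | false | true = m≤n⇒m≤1+n (length-filterᵇ-mono p q w f)
... | false | false = length-filterᵇ-mono p q w f
... | true | false with trans (sym (f y e1)) e2
... | ()

length-filterᵇ-mono-< : ∀ (p q : ℕ → Bool) {x} w → (∀ z → p z ≡ true → q z ≡ true) →
  x ∈ w → p x ≡ false → q x ≡ true →
  length (filterᵇ p w) < length (filterᵇ q w)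
length-filterᵇ-mono-< p q (y ∷ w) f (here refl) e1 e2 rewrite e1 | e2 = s≤s (length-filterᵇ-mono p q w f)
length-filterᵇ-mono-< p q (y ∷ w) f (there m) e1 e2 with p y in a | q y in b
... | true | true = s≤s (length-filterᵇ-mono-< p q w f m e1 e2)
... | false | true = m≤n⇒m≤1+n (length-filterᵇ-mono-< p q w f m e1 e2)
... | false | false = length-filterᵇ-mono-< p q w f m e1 e2
... | true | false with trans (sym (f y a)) b
... | ()

all≡true : ∀ (p : ℕ → Bool) xs → (∀ {x} → x ∈ xs → p x ≡ true) → all p xs ≡ true
all≡true p [] f = refl
all≡true p (x ∷ xs) f = ∧≡true⁺ (f (here refl)) (all≡true p xs (λ m → f (there m)))

all≡true⁻ : ∀ (p : ℕ → Bool) xs → all p xs ≡ true → ∀ {x} → x ∈ xs → p x ≡ true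
all≡true⁻ p (y ∷ xs) e (here refl) = proj₁ (∧≡true⁻ {p y} e)
all≡true⁻ p (y ∷ xs) e (there m) = all≡true⁻ p xs (proj₂ (∧≡true⁻ {p y} e)) m

all≡false : ∀ (p : ℕ → Bool) {x} xs → x ∈ xs → p x ≡ false → all p xs ≡ false
all≡false p (y ∷ xs) (here refl) e rewrite e = refl
all≡false p (y ∷ xs) (there m) e rewrite all≡false p xs m e = ∧-zeroʳ (p y)

all-++ : ∀ (p : ℕ → Bool) xs ys → all p (xs ++ ys) ≡ (all p xs ∧ all p ys)
all-++ p [] ys = refl
all-++ p (x ∷ xs) ys with p x
... | true = all-++ p xs ys
... | false = refl

all-reverse : ∀ (p : ℕ → Bool) xs → all p (reverse xs) ≡ all p xs
all-reverse p [] = refl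
all-reverse p (x ∷ xs) rewrite unfold-reverse x xs | all-++ p (reverse xs) [ x ] | all-reverse p xs
  | ∧-identityʳ (p x) = ∧-comm (all p xs) (p x)

all-<ᵇ-minimum : ∀ (c x : ℕ) (l : List ℕ) → c ∈ l → (∀ {y} → y ∈ l → c ≤ y) →
  all (λ y → x <ᵇ y) l ≡ (x <ᵇ c)
all-<ᵇ-minimum c x l cm h with x <? c
... | yes lt = trans (all≡true (λ y → x <ᵇ y) l (λ m → <ᵇ≡true (<-≤-trans lt (h m)))) (sym (<ᵇ≡true lt))
... | no nl = trans (all≡false (λ y → x <ᵇ y) l cm (<ᵇ≡false nl)) (sym (<ᵇ≡false nl))

≺ᵇ[]⁻ : ∀ (B : List ℕ) x → (B ≺ᵇ (x ∷ [])) ≡ true → ∀ {y} → y ∈ B → y < x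
≺ᵇ[]⁻ B x e m = <ᵇ≡true⇒< (trans (sym (∧-identityʳ _))
  (all≡true⁻ (λ a → all (λ b → a <ᵇ b) (x ∷ [])) B e m))

≺ᵇ[]⁺ : ∀ (B : List ℕ) x → (∀ {y} → y ∈ B → y < x) → (B ≺ᵇ (x ∷ [])) ≡ true
≺ᵇ[]⁺ B x h = all≡true (λ a → all (λ b → a <ᵇ b) (x ∷ [])) B
  (λ m → trans (∧-identityʳ _) (<ᵇ≡true (h m)))

[]≺ᵇ⁻ : ∀ (B : List ℕ) x → ((x ∷ []) ≺ᵇ B) ≡ true → ∀ {y} → y ∈ B → x < y
[]≺ᵇ⁻ B x e m = <ᵇ≡true⇒< (all≡true⁻ (λ b → x <ᵇ b) B (trans (sym (∧-identityʳ _)) e) m)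

[]≺ᵇ⁺ : ∀ (B : List ℕ) x → (∀ {y} → y ∈ B → x < y) → ((x ∷ []) ≺ᵇ B) ≡ true
[]≺ᵇ⁺ B x h = trans (∧-identityʳ _) (all≡true (λ b → x <ᵇ b) B (λ m → <ᵇ≡true (h m)))

[]≺ᵇ-false⁻ : ∀ (B : List ℕ) x → ((x ∷ []) ≺ᵇ B) ≡ false → Σ[ b ∈ ℕ ] (b ∈ B × b ≤ x)
[]≺ᵇ-false⁻ [] x ()
[]≺ᵇ-false⁻ (b ∷ B) x e with x <? b
... | no nl = b , here refl , ≮⇒≥ nl
... | yes lt with []≺ᵇ-false⁻ B x
    (trans (sym (cong (_∧ true) (cong (_∧ all (λ b → x <ᵇ b) B) (<ᵇ≡true lt)))) e)
... | b' , m , le = b' , there m , le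

unique-++⁻ˡ : ∀ (A B : List ℕ) → Unique (A ++ B) → Unique A
unique-++⁻ˡ [] B u = []
unique-++⁻ˡ (x ∷ A) B (h ∷ u) = All.tabulate (λ m → All.lookup h (∈-++⁺ˡ m)) ∷ unique-++⁻ˡ A B u

unique-++⁻ʳ : ∀ (A B : List ℕ) → Unique (A ++ B) → Unique B
unique-++⁻ʳ [] B u = u
unique-++⁻ʳ (x ∷ A) B (h ∷ u) = unique-++⁻ʳ A B u

unique-++-disjoint : ∀ (A B : List ℕ) → Unique (A ++ B) → ∀ {x} → x ∈ A → x ∈ B → ⊥
unique-++-disjoint (y ∷ A) B (h ∷ u) (here refl) mb = All.lookup h (∈-++⁺ʳ A mb) refl
unique-++-disjoint (y ∷ A) B (h ∷ u) (there ma) mb = unique-++-disjoint A B u ma mb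

unique-head : ∀ {x : ℕ} {B : List ℕ} → Unique (x ∷ B) → x ∉ B
unique-head (h ∷ u) m = All.lookup h m refl

∈-remove : ∀ {y x : ℕ} A B → y ∈ A ++ x ∷ B → y ≢ x → y ∈ A ++ B
∈-remove [] B (here refl) ne = ⊥-elim (ne refl)
∈-remove [] B (there m) ne = m
∈-remove (a ∷ A) B (here refl) ne = here refl
∈-remove (a ∷ A) B (there m) ne = there (∈-remove A B m ne)

unique⊆⇒length≤ : ∀ (xs ys : List ℕ) → Unique xs → (∀ {x} → x ∈ xs → x ∈ ys) → length xs ≤ length ys
unique⊆⇒length≤ [] ys u f = z≤n
unique⊆⇒length≤ (x ∷ xs) ys (nx ∷ u) f with ∈-∃++ (f (here refl))
... | A , B , refl = ≤-trans (s≤s (unique⊆⇒length≤ xs (A ++ B) u g))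
      (≤-reflexive (trans (cong suc (length-++ A)) (trans (sym (+-suc (length A) (length B))) (sym (length-++ A)))))
  where
  g : ∀ {y} → y ∈ xs → y ∈ A ++ B
  g {y} m = ∈-remove A B (f (there m)) (λ e → All.lookup nx m (sym e))

interval : ℕ → ℕ → List ℕ
interval lo zero = []
interval lo (suc d) = lo ∷ interval (suc lo) d

∈-interval⁻ : ∀ {y} lo d → y ∈ interval lo d → lo ≤ y × y < lo + d
∈-interval⁻ lo (suc d) (here refl) = ≤-refl , ≤-trans (s≤s (m≤m+n lo d)) (≤-reflexive (sym (+-suc lo d)))
∈-interval⁻ lo (suc d) (there m) with ∈-interval⁻ (suc lo) d m
... | a , b = ≤-trans (n≤1+n lo) a , ≤-trans b (≤-reflexive (sym (+-suc lo d)))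

∈-interval⁺ : ∀ {y} lo d → lo ≤ y → y < lo + d → y ∈ interval lo d
∈-interval⁺ {y} lo zero a b = ⊥-elim (<-irrefl refl (≤-trans b (≤-trans (≤-reflexive (+-identityʳ lo)) a)))
∈-interval⁺ {y} lo (suc d) a b with lo ≟ y
... | yes refl = here refl
... | no ne = there (∈-interval⁺ (suc lo) d (≤∧≢⇒< a ne) (≤-trans b (≤-reflexive (+-suc lo d))))

length-interval : ∀ lo d → length (interval lo d) ≡ d
length-interval lo zero = refl
length-interval lo (suc d) = cong suc (length-interval (suc lo) d)

interval-increasing : ∀ lo d → Increasing (interval lo d)
interval-increasing lo zero = []
interval-increasing lo (suc d) = All.tabulate (λ m → proj₁ (∈-interval⁻ (suc lo) d m)) ∷ interval-increasing (suc lo) d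

increasing⇒unique : ∀ {xs : List ℕ} → Increasing xs → Unique xs
increasing⇒unique = AP.map (λ lt → <⇒≢ lt)

unique⊆interval⇒length≤ : ∀ (xs : List ℕ) lo d → Unique xs → (∀ {x} → x ∈ xs → lo ≤ x × x < lo + d) →
  length xs ≤ d
unique⊆interval⇒length≤ xs lo d u f = ≤-trans
  (unique⊆⇒length≤ xs (interval lo d) u (λ m → let (a , b) = f m in ∈-interval⁺ lo d a b))
  (≤-reflexive (length-interval lo d))

range≡interval : ∀ n → range n ≡ interval 1 n
range≡interval n = go n 1 suc (λ i → refl)
  where
  go : ∀ d lo (f : ℕ → ℕ) → (∀ i → f i ≡ lo + i) → applyUpTo f d ≡ interval lo d
  go zero lo f e = refl
  go (suc d) lo f e = cong₂ _∷_ (trans (e 0) (+-identityʳ lo))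
    (go d (suc lo) (λ i → f (suc i)) (λ i → trans (e (suc i)) (+-suc lo i)))

nth-filterᵇ-interval : ∀ (p : ℕ → Bool) lo d j → j < d → (∀ y → lo ≤ y → y ≤ lo + j → p y ≡ true) →
  nth (filterᵇ p (interval lo d)) (suc j) ≡ lo + j
nth-filterᵇ-interval p lo (suc d) zero lt h rewrite h lo ≤-refl (m≤m+n lo 0) = sym (+-identityʳ lo)
nth-filterᵇ-interval p lo (suc d) (suc j) (s≤s lt) h rewrite h lo ≤-refl (m≤m+n lo (suc j)) =
  trans (nth-filterᵇ-interval p (suc lo) d j lt
    (λ y a b → h y (<⇒≤ a) (≤-trans b (≤-reflexive (sym (+-suc lo j))))))
    (sym (+-suc lo j))

n∸1<n : ∀ {n} → 1 ≤ n → n ∸ 1 < n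
n∸1<n {suc n} _ = ≤-refl

+-∸-fit-≤ : ∀ hi N m → hi < N → m ≤ (N ∸ hi) ∸ 1 → hi + m + 1 ≤ N
+-∸-fit-≤ hi N m lt le =
  ≤-trans (≤-reflexive (+-assoc hi m 1))
    (≤-trans (+-monoʳ-≤ hi (≤-trans (+-monoˡ-≤ 1 le) (≤-reflexive (m∸n+n≡m (m<n⇒0<n∸m lt)))))
      (≤-reflexive (m+[n∸m]≡n (<⇒≤ lt))))

+-∸-fit-< : ∀ hi A m → suc hi ≤ A → m ≤ A ∸ suc hi → hi + m < A
+-∸-fit-< hi A m le1 le2 = ≤-trans (s≤s (+-monoʳ-≤ hi le2)) (≤-reflexive (m+[n∸m]≡n le1))

-- Order-preserving relabellings

nth-∈ : ∀ (V : List ℕ) j → suc j ≤ length V → nth V (suc j) ∈ V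
nth-∈ (v ∷ V) zero _ = here refl
nth-∈ (v ∷ V) (suc j) (s≤s le) = there (nth-∈ V j le)

nth-mono-< : ∀ {V : List ℕ} → Increasing V → ∀ i j → i < j → suc j ≤ length V → nth V (suc i) < nth V (suc j)
nth-mono-< {v ∷ V} (h ∷ ap) zero (suc j) lt (s≤s le) = All.lookup h (nth-∈ V j le)
nth-mono-< {v ∷ V} (h ∷ ap) (suc i) (suc j) (s≤s lt) (s≤s le) = nth-mono-< ap i j lt le

nth-≥ : ∀ {V : List ℕ} b → Increasing V → All (b ≤_) V → ∀ j → suc j ≤ length V → b + j ≤ nth V (suc j)
nth-≥ {v ∷ V} b (h ∷ ap) (bv ∷ bV) zero le = ≤-trans (≤-reflexive (+-identityʳ b)) bv
nth-≥ {v ∷ V} b (h ∷ ap) (bv ∷ bV) (suc j) (s≤s le) =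
  ≤-trans (≤-reflexive (+-suc b j))
    (nth-≥ (suc b) ap (All.tabulate (λ m → ≤-trans (s≤s bv) (All.lookup h m))) j le)

PreservesOrderOn : (ℕ → Set) → (ℕ → ℕ) → Set
PreservesOrderOn D f = ∀ {x y} → D x → D y → (f x <ᵇ f y) ≡ (x <ᵇ y)

strictMonoOn⇒preservesOrderOn : ∀ (D : ℕ → Set) (f : ℕ → ℕ) → (∀ {x y} → D x → D y → x < y → f x < f y) →
  PreservesOrderOn D f
strictMonoOn⇒preservesOrderOn D f mono {x} {y} dx dy with <-cmp x y
... | tri< a _ _ = trans (<ᵇ≡true (mono dx dy a)) (sym (<ᵇ≡true a))
... | tri≈ _ refl _ = trans (<ᵇ-irrefl (f x)) (sym (<ᵇ-irrefl x))
... | tri> _ _ c = trans (<ᵇ≡false (<⇒≯ (mono dy dx c))) (sym (<ᵇ≡false (<⇒≯ c)))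

Position : List ℕ → ℕ → Set
Position V r = 1 ≤ r × r ≤ length V

nth-preservesOrderOn : ∀ {V : List ℕ} → Increasing V → PreservesOrderOn (Position V) (nth V)
nth-preservesOrderOn {V} ap = strictMonoOn⇒preservesOrderOn (Position V) (nth V) mono
  where
  mono : ∀ {x y} → Position V x → Position V y → x < y → nth V x < nth V y
  mono {suc i} {suc j} (_ , _) (_ , lej) (s≤s lt) = nth-mono-< ap i j lt lej

preservesOrderOn-∘ : ∀ (D E : ℕ → Set) (f g : ℕ → ℕ) → PreservesOrderOn D f →
  PreservesOrderOn E g → (∀ {x} → D x → E (f x)) →
  PreservesOrderOn D (λ x → g (f x))
preservesOrderOn-∘ D E f g of og df {x} {y} dx dy = trans (og (df dx) (df dy)) (of dx dy)

preservesOrderOn-∷⁻ : ∀ {x : ℕ} {a : List ℕ} (f : ℕ → ℕ) → PreservesOrderOn (_∈ (x ∷ a)) f →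
  PreservesOrderOn (_∈ a) f
preservesOrderOn-∷⁻ f o m1 m2 = o (there m1) (there m2)

preservesOrderOn-reverse : ∀ (f : ℕ → ℕ) a → PreservesOrderOn (_∈ a) f → PreservesOrderOn (_∈ reverse a) f
preservesOrderOn-reverse f a o m1 m2 = o (reverse⁻ m1) (reverse⁻ m2)

countBelow : List ℕ → ℕ → ℕ
countBelow w x = length (filterᵇ (λ y → y <ᵇ x) w)

-- st w = map (rank w) w holds definitionally.
rank : List ℕ → ℕ → ℕ
rank w x = suc (countBelow w x)

rank≤length : ∀ {x} w → x ∈ w → rank w x ≤ length w
rank≤length {x} w m = length-filterᵇ-< (λ y → y <ᵇ x) w m (<ᵇ-irrefl x)

rank-preservesOrderOn : ∀ w → PreservesOrderOn (_∈ w) (rank w)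
rank-preservesOrderOn w = strictMonoOn⇒preservesOrderOn (_∈ w) (rank w) mono
  where
  mono : ∀ {x y} → x ∈ w → y ∈ w → x < y → rank w x < rank w y
  mono {x} {y} mx my lt = s≤s (length-filterᵇ-mono-< (λ z → z <ᵇ x) (λ z → z <ᵇ y) w
    (λ z e → <ᵇ≡true (<-trans (<ᵇ≡true⇒< e) lt)) mx (<ᵇ-irrefl x) (<ᵇ≡true lt))

-- Statistics of a word around its maximum

data SameUpDown : List ℕ → List ℕ → Set where
  empty : SameUpDown [] []
  single : ∀ x y → SameUpDown (x ∷ []) (y ∷ [])
  extend : ∀ {x y x' y' l l'} → (x <ᵇ x') ≡ (y <ᵇ y') → (x' <ᵇ x) ≡ (y' <ᵇ y) →
        SameUpDown (x' ∷ l) (y' ∷ l') → SameUpDown (x ∷ x' ∷ l) (y ∷ y' ∷ l')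

asc-sameUpDown : ∀ {l l'} → SameUpDown l l' → asc l ≡ asc l'
asc-sameUpDown empty = refl
asc-sameUpDown (single x y) = refl
asc-sameUpDown (extend e1 e2 a) = cong₂ _+_ (cong b2n e1) (asc-sameUpDown a)

ldr-sameUpDown : ∀ {l l'} → SameUpDown l l' → ldr l ≡ ldr l'
ldr-sameUpDown empty = refl
ldr-sameUpDown (single x y) = refl
ldr-sameUpDown (extend {x} {y} {x'} {y'} e1 e2 a) rewrite e2 with y' <ᵇ y
... | true = cong suc (ldr-sameUpDown a)
... | false = refl

lir-sameUpDown : ∀ {l l'} → SameUpDown l l' → lir l ≡ lir l'
lir-sameUpDown empty = refl
lir-sameUpDown (single x y) = refl
lir-sameUpDown (extend {x} {y} {x'} {y'} e1 e2 a) rewrite e1 with y <ᵇ y'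
... | true = cong suc (lir-sameUpDown a)
... | false = refl

map-sameUpDown : ∀ (f : ℕ → ℕ) a → PreservesOrderOn (_∈ a) f → SameUpDown (map f a) a
map-sameUpDown f [] o = empty
map-sameUpDown f (x ∷ []) o = single (f x) x
map-sameUpDown f (x ∷ y ∷ a) o = extend (o (here refl) (there (here refl))) (o (there (here refl)) (here refl))
  (map-sameUpDown f (y ∷ a) (preservesOrderOn-∷⁻ f o))

sameUpDown-around-maximum : ∀ (n : ℕ) (f g : ℕ → ℕ) a b → PreservesOrderOn (_∈ a) f →
  PreservesOrderOn (_∈ b) g →
  (∀ {x} → x ∈ a → x < n × f x < n) → (∀ {x} → x ∈ b → x < n × g x < n) →
  SameUpDown (map f a ++ n ∷ map g b) (a ++ n ∷ b)
sameUpDown-around-maximum n f g [] [] of og ha hb = single n n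
sameUpDown-around-maximum n f g [] (y ∷ b) of og ha hb =
  let (p , q) = hb (here refl) in
  extend (trans (<ᵇ≡false (<⇒≯ q)) (sym (<ᵇ≡false (<⇒≯ p))))
    (trans (<ᵇ≡true q) (sym (<ᵇ≡true p)))
    (map-sameUpDown g (y ∷ b) og)
sameUpDown-around-maximum n f g (x ∷ []) b of og ha hb =
  let (p , q) = ha (here refl) in
  extend (trans (<ᵇ≡true q) (sym (<ᵇ≡true p))) (trans (<ᵇ≡false (<⇒≯ q)) (sym (<ᵇ≡false (<⇒≯ p))))
    (sameUpDown-around-maximum n f g [] b (λ ()) og (λ ()) hb)
sameUpDown-around-maximum n f g (x ∷ y ∷ a) b of og ha hb =
  extend (of (here refl) (there (here refl))) (of (there (here refl)) (here refl))
    (sameUpDown-around-maximum n f g (y ∷ a) b (preservesOrderOn-∷⁻ f of) og (λ m → ha (there m)) hb)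

all-map-preservesOrder : ∀ (g : ℕ → ℕ) (q : ℕ → ℕ → Bool) x r → (∀ {y} → y ∈ r → q (g y) (g x) ≡ q y x) →
  all (λ y → q y (g x)) (map g r) ≡ all (λ y → q y x) r
all-map-preservesOrder g q x [] h = refl
all-map-preservesOrder g q x (y ∷ r) h = cong₂ _∧_ (h (here refl)) (all-map-preservesOrder g q x r (λ m → h (there m)))

rmax-map : ∀ (g : ℕ → ℕ) b → PreservesOrderOn (_∈ b) g → rmax (map g b) ≡ rmax b
rmax-map g [] o = refl
rmax-map g (x ∷ b) o = cong₂ _+_ (cong b2n (all-map-preservesOrder g _<ᵇ_ x b (λ m → o (there m) (here refl))))
  (rmax-map g b (preservesOrderOn-∷⁻ g o))

rmin-map : ∀ (g : ℕ → ℕ) b → PreservesOrderOn (_∈ b) g → rmin (map g b) ≡ rmin b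
rmin-map g [] o = refl
rmin-map g (x ∷ b) o = cong₂ _+_
  (cong b2n (all-map-preservesOrder g (λ y x → x <ᵇ y) x b (λ m → o (here refl) (there m))))
  (rmin-map g b (preservesOrderOn-∷⁻ g o))

rmax-++-maximum : ∀ n a b → All (_< n) a → All (_< n) b → rmax (a ++ n ∷ b) ≡ suc (rmax b)
rmax-++-maximum n [] b ha hb rewrite all≡true (λ y → y <ᵇ n) b (λ m → <ᵇ≡true (All.lookup hb m)) = refl
rmax-++-maximum n (x ∷ a) b (p ∷ ha) hb
  rewrite all≡false (λ y → y <ᵇ x) (a ++ n ∷ b) (∈-insert a) (<ᵇ≡false (<⇒≯ p)) = rmax-++-maximum n a b ha hb

reverse-++-∷ : ∀ (n : ℕ) (a b : List ℕ) → reverse (a ++ n ∷ b) ≡ reverse b ++ n ∷ reverse a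
reverse-++-∷ n a b rewrite reverse-++ a (n ∷ b) | unfold-reverse n b = ++-assoc (reverse b) [ n ] (reverse a)

All-reverse : ∀ {P : ℕ → Set} (a : List ℕ) → All P a → All P (reverse a)
All-reverse a h = All.tabulate (λ m → All.lookup h (reverse⁻ m))

-- Minima counted only at letters satisfying P, which will record the comparison with the letters on the
-- other side of the maximum.
rminWith : (ℕ → Bool) → List ℕ → ℕ
rminWith P [] = 0
rminWith P (x ∷ r) = b2n (all (λ y → x <ᵇ y) r ∧ P x) + rminWith P r

lminWith : (ℕ → Bool) → List ℕ → List ℕ → ℕ
lminWith P pre [] = 0
lminWith P pre (x ∷ r) = b2n (all (λ y → x <ᵇ y) pre ∧ P x) + lminWith P (pre ++ [ x ]) r

rmin-++-maximum : ∀ n a b → All (_< n) a → All (_< n) b → b ≢ [] →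
  rmin (a ++ n ∷ b) ≡ rminWith (λ x → all (λ y → x <ᵇ y) b) a + rmin b
rmin-++-maximum n [] [] ha hb ne = ⊥-elim (ne refl)
rmin-++-maximum n [] (y ∷ b) ha (p ∷ hb) ne rewrite <ᵇ≡false {n} {y} (<⇒≯ p) = refl
rmin-++-maximum n (x ∷ a) b (p ∷ ha) hb ne
  rewrite all-++ (λ y → x <ᵇ y) a (n ∷ b) | <ᵇ≡true p
  = trans (cong (b2n (all (λ y → x <ᵇ y) a ∧ all (λ y → x <ᵇ y) b) +_) (rmin-++-maximum n a b ha hb ne))
      (sym (+-assoc (b2n (all (λ y → x <ᵇ y) a ∧ all (λ y → x <ᵇ y) b)) _ _))

rminWith-reverse : ∀ P τ pre → rminWith P (reverse τ ++ reverse pre) ≡ lminWith P pre τ + rminWith P (reverse pre)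
rminWith-reverse P [] pre = refl
rminWith-reverse P (x ∷ r) pre =
  begin
    rminWith P (reverse (x ∷ r) ++ reverse pre)
  ≡⟨ cong (λ l → rminWith P (l ++ reverse pre)) (unfold-reverse x r) ⟩
    rminWith P ((reverse r ++ [ x ]) ++ reverse pre)
  ≡⟨ cong (rminWith P) (++-assoc (reverse r) [ x ] (reverse pre)) ⟩
    rminWith P (reverse r ++ x ∷ reverse pre)
  ≡⟨ cong (λ l → rminWith P (reverse r ++ l)) (sym e) ⟩
    rminWith P (reverse r ++ reverse (pre ++ [ x ]))
  ≡⟨ rminWith-reverse P r (pre ++ [ x ]) ⟩
    lminWith P (pre ++ [ x ]) r + rminWith P (reverse (pre ++ [ x ]))
  ≡⟨ cong (λ l → lminWith P (pre ++ [ x ]) r + rminWith P l) e ⟩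
    lminWith P (pre ++ [ x ]) r + (b2n (all (λ y → x <ᵇ y) (reverse pre) ∧ P x) + rminWith P (reverse pre))
  ≡⟨ cong (λ t → lminWith P (pre ++ [ x ]) r + (b2n (t ∧ P x) + rminWith P (reverse pre)))
      (all-reverse (λ y → x <ᵇ y) pre) ⟩
    lminWith P (pre ++ [ x ]) r + (b2n (all (λ y → x <ᵇ y) pre ∧ P x) + rminWith P (reverse pre))
  ≡⟨ sym (+-assoc (lminWith P (pre ++ [ x ]) r) _ _) ⟩
    lminWith P (pre ++ [ x ]) r + b2n (all (λ y → x <ᵇ y) pre ∧ P x) + rminWith P (reverse pre)
  ≡⟨ cong (_+ rminWith P (reverse pre)) (+-comm (lminWith P (pre ++ [ x ]) r) _) ⟩
    lminWith P pre (x ∷ r) + rminWith P (reverse pre)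
  ∎
  where
  open ≡-Reasoning
  e : reverse (pre ++ [ x ]) ≡ x ∷ reverse pre
  e = reverse-++ pre [ x ]

rminWith-reverse-[] : ∀ P τ → rminWith P (reverse τ) ≡ lminWith P [] τ
rminWith-reverse-[] P τ =
  trans (cong (rminWith P) (sym (++-identityʳ (reverse τ)))) (trans (rminWith-reverse P τ []) (+-identityʳ _))

reverse-≢-[] : ∀ (a : List ℕ) → a ≢ [] → reverse a ≢ []
reverse-≢-[] a a≢[] e = a≢[] (trans (sym (reverse-involutive a)) (cong reverse e))

lmin-++-maximum : ∀ n a b → All (_< n) a → All (_< n) b → a ≢ [] →
  lmin (a ++ n ∷ b) ≡ lminWith (λ x → all (λ y → x <ᵇ y) (reverse a)) [] b + lmin a
lmin-++-maximum n a b ha hb ne =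
  begin
    rmin (reverse (a ++ n ∷ b))
  ≡⟨ cong rmin (reverse-++-∷ n a b) ⟩
    rmin (reverse b ++ n ∷ reverse a)
  ≡⟨ rmin-++-maximum n (reverse b) (reverse a) (All-reverse b hb) (All-reverse a ha) ne' ⟩
    rminWith _ (reverse b) + rmin (reverse a)
  ≡⟨ cong (_+ rmin (reverse a)) (rminWith-reverse-[] _ b) ⟩
    lminWith (λ x → all (λ y → x <ᵇ y) (reverse a)) [] b + lmin a
  ∎
  where
  open ≡-Reasoning
  ne' : reverse a ≢ []
  ne' = reverse-≢-[] a ne

lminWith-map : ∀ (D : ℕ → Set) (g : ℕ → ℕ) (P : ℕ → Bool) pre r → PreservesOrderOn D g →
  (∀ {y} → y ∈ pre → D y) → (∀ {y} → y ∈ r → D y) →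
  lminWith P (map g pre) (map g r) ≡ lminWith (λ x → P (g x)) pre r
lminWith-map D g P pre [] o hp hr = refl
lminWith-map D g P pre (x ∷ r) o hp hr =
  cong₂ _+_ (cong (λ t → b2n (t ∧ P (g x)))
      (all-map-preservesOrder g (λ y x → x <ᵇ y) x pre (λ m → o (hr (here refl)) (hp m))))
    (trans (cong (λ l → lminWith P l (map g r)) (sym (map-++ g pre [ x ])))
      (lminWith-map D g P (pre ++ [ x ]) r o hp' (λ m → hr (there m))))
  where
  hp' : ∀ {y} → y ∈ pre ++ [ x ] → D y
  hp' m with ∈-++⁻ pre m
  ... | inj₁ q = hp q
  ... | inj₂ (here refl) = hr (here refl)

lminWith-++ : ∀ P pre A B → lminWith P pre (A ++ B) ≡ lminWith P pre A + lminWith P (pre ++ A) B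
lminWith-++ P pre [] B = cong (λ l → lminWith P l B) (sym (++-identityʳ pre))
lminWith-++ P pre (x ∷ A) B =
  trans (cong (b2n (all (λ y → x <ᵇ y) pre ∧ P x) +_)
          (trans (lminWith-++ P (pre ++ [ x ]) A B)
            (cong (λ l → lminWith P (pre ++ [ x ]) A + lminWith P l B) (++-assoc pre [ x ] A))))
        (sym (+-assoc (b2n (all (λ y → x <ᵇ y) pre ∧ P x)) _ _))

lminWith-none : ∀ P pre A → (∀ {x} → x ∈ A → P x ≡ false) → lminWith P pre A ≡ 0
lminWith-none P pre [] h = refl
lminWith-none P pre (x ∷ A) h rewrite h (here refl) | ∧-zeroʳ (all (λ y → x <ᵇ y) pre)
  = lminWith-none P (pre ++ [ x ]) A (λ m → h (there m))

lminWith-cong : ∀ P Q (z : ℕ) pre r → z ∈ pre → (∀ {x} → x ∈ r → P x ≡ Q x ⊎ z < x) →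
  lminWith P pre r ≡ lminWith Q pre r
lminWith-cong P Q z pre [] zm h = refl
lminWith-cong P Q z pre (x ∷ r) zm h = cong₂ _+_ hd
  (lminWith-cong P Q z (pre ++ [ x ]) r (∈-++⁺ˡ zm) (λ m → h (there m)))
  where
  hd : b2n (all (λ y → x <ᵇ y) pre ∧ P x) ≡ b2n (all (λ y → x <ᵇ y) pre ∧ Q x)
  hd with h (here refl)
  ... | inj₁ e = cong (λ t → b2n (all (λ y → x <ᵇ y) pre ∧ t)) e
  ... | inj₂ lt rewrite all≡false (λ y → x <ᵇ y) pre zm (<ᵇ≡false (<⇒≯ lt)) = refl

lminWith-gains-one : ∀ P Q τ1 z τ2 → (∀ {x} → x ∈ τ1 → P x ≡ false × Q x ≡ false) →
  P z ≡ false → Q z ≡ true →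
  all (λ y → z <ᵇ y) τ1 ≡ true → (∀ {x} → x ∈ τ2 → P x ≡ Q x ⊎ z < x) →
  lminWith Q [] (τ1 ++ z ∷ τ2) ≡ suc (lminWith P [] (τ1 ++ z ∷ τ2))
lminWith-gains-one P Q τ1 z τ2 h1 pz qz az h2
  rewrite lminWith-++ Q [] τ1 (z ∷ τ2) | lminWith-++ P [] τ1 (z ∷ τ2)
        | lminWith-none Q [] τ1 (λ m → proj₂ (h1 m)) | lminWith-none P [] τ1 (λ m → proj₁ (h1 m))
        | az | pz | qz
  = cong suc (sym (lminWith-cong P Q z (τ1 ++ [ z ]) τ2 (∈-insert τ1) h2))

map-≢-[] : ∀ (h : ℕ → ℕ) xs → xs ≢ [] → map h xs ≢ []
map-≢-[] h [] xs≢[] _ = xs≢[] refl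
map-≢-[] h (x ∷ xs) _ ()

module AroundMaximum (n : ℕ) (σ τ : List ℕ) (f g : ℕ → ℕ)
  (f-order : PreservesOrderOn (_∈ σ) f) (g-order : PreservesOrderOn (_∈ τ) g)
  (σ-bounds : ∀ {x} → x ∈ σ → x < n × f x < n) (τ-bounds : ∀ {x} → x ∈ τ → x < n × g x < n) where

  σ<n : All (_< n) σ
  σ<n = All.tabulate (proj₁ ∘ σ-bounds)

  τ<n : All (_< n) τ
  τ<n = All.tabulate (proj₁ ∘ τ-bounds)

  fσ<n : All (_< n) (map f σ)
  fσ<n = All-map⁺ (All.tabulate (proj₂ ∘ σ-bounds))

  gτ<n : All (_< n) (map g τ)
  gτ<n = All-map⁺ (All.tabulate (proj₂ ∘ τ-bounds))

  sameUpDown : SameUpDown (map f σ ++ n ∷ map g τ) (σ ++ n ∷ τ)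
  sameUpDown = sameUpDown-around-maximum n f g σ τ f-order g-order σ-bounds τ-bounds

  rmax-image : rmax (map f σ ++ n ∷ map g τ) ≡ rmax (σ ++ n ∷ τ)
  rmax-image = begin
    rmax (map f σ ++ n ∷ map g τ)  ≡⟨ rmax-++-maximum n (map f σ) (map g τ) fσ<n gτ<n ⟩
    suc (rmax (map g τ))           ≡⟨ cong suc (rmax-map g τ g-order) ⟩
    suc (rmax τ)                   ≡⟨ rmax-++-maximum n σ τ σ<n τ<n ⟨
    rmax (σ ++ n ∷ τ)              ∎
    where open ≡-Reasoning

  lmax-image : lmax (map f σ ++ n ∷ map g τ) ≡ lmax (σ ++ n ∷ τ)
  lmax-image = begin
    rmax (reverse (map f σ ++ n ∷ map g τ))           ≡⟨ cong rmax (reverse-++-∷ n (map f σ) (map g τ)) ⟩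
    rmax (reverse (map g τ) ++ n ∷ reverse (map f σ)) ≡⟨ rmax-++-maximum n _ _ (All-reverse _ gτ<n) (All-reverse _ fσ<n) ⟩
    suc (rmax (reverse (map f σ)))                    ≡⟨ cong (suc ∘ rmax) (reverse-map f σ) ⟨
    suc (rmax (map f (reverse σ)))                    ≡⟨ cong suc (rmax-map f (reverse σ) (preservesOrderOn-reverse f σ f-order)) ⟩
    suc (rmax (reverse σ))                            ≡⟨ rmax-++-maximum n (reverse τ) (reverse σ) (All-reverse _ τ<n) (All-reverse _ σ<n) ⟨
    rmax (reverse τ ++ n ∷ reverse σ)                 ≡⟨ cong rmax (reverse-++-∷ n σ τ) ⟨
    rmax (reverse (σ ++ n ∷ τ))                       ∎
    where open ≡-Reasoning

  lmin-image : σ ≢ [] →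
    lmin (map f σ ++ n ∷ map g τ) ≡ lminWith (λ x → all (λ y → g x <ᵇ y) (reverse (map f σ))) [] τ + lmin σ
  lmin-image σ≢[] = begin
    lmin (map f σ ++ n ∷ map g τ)
      ≡⟨ lmin-++-maximum n (map f σ) (map g τ) fσ<n gτ<n (map-≢-[] f σ σ≢[]) ⟩
    lminWith _ [] (map g τ) + lmin (map f σ)
      ≡⟨ cong₂ _+_ (lminWith-map (_∈ τ) g _ [] τ g-order (λ ()) id) lmin-fσ ⟩
    lminWith (λ x → all (λ y → g x <ᵇ y) (reverse (map f σ))) [] τ + lmin σ ∎
    where
    open ≡-Reasoning
    lmin-fσ : lmin (map f σ) ≡ lmin σ
    lmin-fσ = trans (cong rmin (sym (reverse-map f σ))) (rmin-map f (reverse σ) (preservesOrderOn-reverse f σ f-order))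

-- Sorting, runs and shifted blocks

∈-insert⁻ : ∀ {y} x l → y ∈ insert x l → y ≡ x ⊎ y ∈ l
∈-insert⁻ x [] (here e) = inj₁ e
∈-insert⁻ x (z ∷ l) m with z <ᵇ x
∈-insert⁻ x (z ∷ l) (here e) | true = inj₂ (here e)
∈-insert⁻ x (z ∷ l) (there m) | true with ∈-insert⁻ x l m
... | inj₁ e = inj₁ e
... | inj₂ q = inj₂ (there q)
∈-insert⁻ x (z ∷ l) (here e) | false = inj₁ e
∈-insert⁻ x (z ∷ l) (there m) | false = inj₂ m

∈-insert⁺ : ∀ {y} x l → y ≡ x ⊎ y ∈ l → y ∈ insert x l
∈-insert⁺ x [] (inj₁ e) = here e
∈-insert⁺ x (z ∷ l) h with z <ᵇ x
∈-insert⁺ x (z ∷ l) (inj₁ e) | true = there (∈-insert⁺ x l (inj₁ e))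
∈-insert⁺ x (z ∷ l) (inj₂ (here e)) | true = here e
∈-insert⁺ x (z ∷ l) (inj₂ (there m)) | true = there (∈-insert⁺ x l (inj₂ m))
∈-insert⁺ x (z ∷ l) (inj₁ e) | false = here e
∈-insert⁺ x (z ∷ l) (inj₂ m) | false = there m

length-insert : ∀ x l → length (insert x l) ≡ suc (length l)
length-insert x [] = refl
length-insert x (z ∷ l) with z <ᵇ x
... | true = cong suc (length-insert x l)
... | false = refl

insert-increasing : ∀ x l → Increasing l → x ∉ l → Increasing (insert x l)
insert-increasing x [] ap nm = [] ∷ []
insert-increasing x (z ∷ l) (h ∷ ap) nm with z <ᵇ x in e
... | true = All.tabulate g ∷ insert-increasing x l ap (λ m → nm (there m))
  where
  g : ∀ {y} → y ∈ insert x l → z < y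
  g m with ∈-insert⁻ x l m
  ... | inj₁ refl = <ᵇ≡true⇒< e
  ... | inj₂ q = All.lookup h q
... | false = All.tabulate g ∷ h ∷ ap
  where
  x<z : x < z
  x<z = ≤∧≢⇒< (<ᵇ≡false⇒≥ e) (λ eq → nm (here eq))
  g : ∀ {y} → y ∈ z ∷ l → x < y
  g (here refl) = x<z
  g (there q) = <-trans x<z (All.lookup h q)

∈-sort⁻ : ∀ {y} l → y ∈ sort l → y ∈ l
∈-sort⁻ (x ∷ l) m with ∈-insert⁻ x (sort l) m
... | inj₁ refl = here refl
... | inj₂ q = there (∈-sort⁻ l q)

∈-sort⁺ : ∀ {y} l → y ∈ l → y ∈ sort l
∈-sort⁺ (x ∷ l) (here e) = ∈-insert⁺ x (sort l) (inj₁ e)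
∈-sort⁺ (x ∷ l) (there m) = ∈-insert⁺ x (sort l) (inj₂ (∈-sort⁺ l m))

length-sort : ∀ l → length (sort l) ≡ length l
length-sort [] = refl
length-sort (x ∷ l) = trans (length-insert x (sort l)) (cong suc (length-sort l))

sort-increasing : ∀ l → Unique l → Increasing (sort l)
sort-increasing [] u = []
sort-increasing (x ∷ l) (h ∷ u) = insert-increasing x (sort l) (sort-increasing l u)
  (λ m → All.lookup h (∈-sort⁻ l m) refl)

sort-increasing-id : ∀ l → Increasing l → sort l ≡ l
sort-increasing-id [] ap = refl
sort-increasing-id (x ∷ l) (h ∷ ap) rewrite sort-increasing-id l ap = ins h
  where
  ins : ∀ {l} → All (x <_) l → insert x l ≡ x ∷ l
  ins {[]} _ = refl
  ins {z ∷ l} (p ∷ _) rewrite <ᵇ≡false {z} {x} (<⇒≯ p) = refl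

block : ℕ → ℕ → List ℕ
block a k = a ∷ interval (suc a) k

block′ : ℕ × ℕ → List ℕ
block′ (a , k) = block a k

∈-block⁻ : ∀ {y} a k → y ∈ block a k → a ≤ y × y ≤ a + k
∈-block⁻ a k (here refl) = ≤-refl , m≤m+n a k
∈-block⁻ a k (there m) with ∈-interval⁻ (suc a) k m
... | p , q = <⇒≤ p , ≤-pred q

∈-block⁺ : ∀ {y} a k → a ≤ y → y ≤ a + k → y ∈ block a k
∈-block⁺ {y} a k p q with a ≟ y
... | yes refl = here refl
... | no ne = there (∈-interval⁺ (suc a) k (≤∧≢⇒< p ne) (s≤s q))

block-increasing : ∀ a k → Increasing (block a k)
block-increasing a k = All.tabulate (λ m → proj₁ (∈-interval⁻ (suc a) k m)) ∷ interval-increasing (suc a) k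

Separated : List (ℕ × ℕ) → Set
Separated [] = ⊤
Separated (_ ∷ []) = ⊤
Separated ((a , k) ∷ (a' , k') ∷ ps) = suc (a + k) < a' × Separated ((a' , k') ∷ ps)

runs-sorted : ∀ s → Increasing s →
  Σ[ ps ∈ List (ℕ × ℕ) ] (runs s ≡ map block′ ps × concat (map block′ ps) ≡ s × Separated ps)
runs-sorted [] ap = [] , refl , refl , tt
runs-sorted (x ∷ xs) (h ∷ ap) with runs-sorted xs ap
... | [] , e1 , e2 , g rewrite e1 | sym e2 = (x , 0) ∷ [] , refl , refl , tt
... | (a , k) ∷ ps , e1 , e2 , g rewrite e1 = step (suc x ≡ᵇ a) refl
  where
  x<a : x < a
  x<a = All.lookup h (subst (a ∈_) e2 (here refl))
  gp : ∀ ps → Separated ((suc x , k) ∷ ps) → Separated ((x , suc k) ∷ ps)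
  gp [] _ = tt
  gp ((a' , k') ∷ ps) (lt , g) = ≤-trans (s≤s (s≤s (≤-reflexive (+-suc x k)))) lt , g
  step : ∀ b → (suc x ≡ᵇ a) ≡ b →
    Σ[ qs ∈ List (ℕ × ℕ) ] ((if b then (x ∷ a ∷ interval (suc a) k) ∷ map block′ ps
        else (x ∷ []) ∷ (a ∷ interval (suc a) k) ∷ map block′ ps) ≡ map block′ qs
      × concat (map block′ qs) ≡ x ∷ xs × Separated qs)
  step true eq with ≡ᵇ≡true⇒≡ {suc x} {a} eq
  ... | refl = (x , suc k) ∷ ps , refl , cong (x ∷_) e2 , gp ps g
  step false eq = (x , 0) ∷ (a , k) ∷ ps , refl , cong (x ∷_) e2 , lt , g
    where
    lt : suc (x + 0) < a
    lt rewrite +-identityʳ x = ≤∧≢⇒< x<a (λ e → not-¬ (≡ᵇ≡true e) eq)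

separated-above : ∀ a k ps → Separated ((a , k) ∷ ps) → ∀ {y} → y ∈ concat (map block′ ps) → suc (a + k) < y
separated-above a k ((a' , k') ∷ ps) (lt , g) {y} m with ∈-++⁻ (block a' k') m
... | inj₁ q = <-≤-trans lt (proj₁ (∈-block⁻ a' k' q))
... | inj₂ q = <-trans lt (≤-<-trans (≤-trans (n≤1+n a') (s≤s (m≤m+n a' k'))) (separated-above a' k' ps g q))

adjacentPairs : List (List ℕ) → List (List ℕ × List ℕ)
adjacentPairs [] = []
adjacentPairs (B ∷ []) = (B , []) ∷ []
adjacentPairs (B ∷ B' ∷ bs) = (B , B') ∷ adjacentPairs (B' ∷ bs)

zip≡adjacentPairs : ∀ (B : List ℕ) bs → zip (B ∷ bs) (bs ++ [] ∷ []) ≡ adjacentPairs (B ∷ bs)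
zip≡adjacentPairs B [] = refl
zip≡adjacentPairs B (B' ∷ bs) = cong ((B , B') ∷_) (zip≡adjacentPairs B' bs)

shiftBlock : (List ℕ → List ℕ → ℕ) → List ℕ × List ℕ → List ℕ
shiftBlock M (B , B') = map (λ x → x + M B B' + 1) B

interval-shift : ∀ c lo d → map (λ x → x + c + 1) (interval lo d) ≡ interval (lo + c + 1) d
interval-shift c lo zero = refl
interval-shift c lo (suc d) = cong ((lo + c + 1) ∷_) (interval-shift c (suc lo) d)

block-shift : ∀ c a k → map (λ x → x + c + 1) (block a k) ≡ block (a + c + 1) k
block-shift c a k = cong ((a + c + 1) ∷_) (interval-shift c (suc a) k)

Fits : (List ℕ → List ℕ → ℕ) → ℕ → List (ℕ × ℕ) → Set
Fits M N [] = ⊤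
Fits M N ((a , k) ∷ []) = a + k + M (block a k) [] + 1 ≤ N
Fits M N ((a , k) ∷ (a' , k') ∷ ps) = a + k + M (block a k) (block a' k') < a' × Fits M N ((a' , k') ∷ ps)

nextBlock : List (ℕ × ℕ) → List ℕ
nextBlock [] = []
nextBlock (p ∷ _) = block′ p

-- The set L of ψ: every block σᵢ is shifted up by mᵢ + 1.
shiftedBlocks : (List ℕ → List ℕ → ℕ) → List (ℕ × ℕ) → List ℕ
shiftedBlocks M ps = concat (map (shiftBlock M) (adjacentPairs (map block′ ps)))

shiftedBlocks-∷ : ∀ M a k ps → shiftedBlocks M ((a , k) ∷ ps) ≡
  block (a + M (block a k) (nextBlock ps) + 1) k ++ shiftedBlocks M ps
shiftedBlocks-∷ M a k [] = cong₂ _++_ (block-shift (M (block a k) []) a k) refl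
shiftedBlocks-∷ M a k (p ∷ ps) = cong₂ _++_ (block-shift (M (block a k) (block′ p)) a k) refl

+-shift-block : ∀ a m k → a + m + 1 + k ≡ suc (a + k + m)
+-shift-block = solve-∀

shiftedBlocks-increasing : ∀ M N a k ps → Fits M N ((a , k) ∷ ps) →
  Increasing (shiftedBlocks M ((a , k) ∷ ps)) ×
  All (λ y → a + M (block a k) (nextBlock ps) + 1 ≤ y × y ≤ N) (shiftedBlocks M ((a , k) ∷ ps)) ×
  Σ[ r ∈ List ℕ ] (shiftedBlocks M ((a , k) ∷ ps) ≡ (a + M (block a k) (nextBlock ps) + 1) ∷ r)
shiftedBlocks-increasing M N a k [] gd rewrite shiftedBlocks-∷ M a k []
  | ++-identityʳ (block (a + M (block a k) [] + 1) k) =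
  block-increasing _ k , All.tabulate bnd , _ , refl
  where
  m = M (block a k) []
  bnd : ∀ {y} → y ∈ block (a + m + 1) k → a + m + 1 ≤ y × y ≤ N
  bnd mm with ∈-block⁻ (a + m + 1) k mm
  ... | p , q = p , ≤-trans q (≤-trans (≤-reflexive (trans (+-shift-block a m k) (+-comm 1 (a + k + m)))) gd)
shiftedBlocks-increasing M N a k ((a' , k') ∷ ps) (lt , gd) with shiftedBlocks-increasing M N a' k' ps gd
... | ap , al , r , er rewrite shiftedBlocks-∷ M a k ((a' , k') ∷ ps) =
  APP.++⁺ (block-increasing _ k) ap (All.tabulate (λ mm → All.tabulate (λ mm' → lt2 mm mm'))) ,
  All.tabulate bnd , _ , refl
  where
  m = M (block a k) (block a' k')
  m' = M (block a' k') (nextBlock ps)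
  key : a + m + 1 + k < a' + m' + 1
  key = ≤-trans (≤-reflexive (cong suc (+-shift-block a m k)))
    (≤-trans (s≤s lt) (≤-trans (s≤s (m≤m+n a' m')) (≤-reflexive (+-comm 1 (a' + m')))))
  lt2 : ∀ {x y} → x ∈ block (a + m + 1) k → y ∈ shiftedBlocks M ((a' , k') ∷ ps) → x < y
  lt2 mm mm' = <-≤-trans (≤-<-trans (proj₂ (∈-block⁻ _ k mm)) key) (proj₁ (All.lookup al mm'))
  bnd : ∀ {y} → y ∈ block (a + m + 1) k ++ shiftedBlocks M ((a' , k') ∷ ps) → a + m + 1 ≤ y × y ≤ N
  bnd mm with ∈-++⁻ (block (a + m + 1) k) mm
  ... | inj₁ q = proj₁ (∈-block⁻ _ k q) ,
      <⇒≤ (<-≤-trans (≤-<-trans (proj₂ (∈-block⁻ _ k q)) key)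
      (proj₂ (All.lookup al (subst ((a' + m' + 1) ∈_) (sym er) (here refl)))))
  ... | inj₂ q = <⇒≤ (≤-<-trans (m≤m+n (a + m + 1) k) (<-≤-trans key (proj₁ (All.lookup al q))))
      , proj₂ (All.lookup al q)

length-shiftedBlocks : ∀ M ps → length (shiftedBlocks M ps) ≡ length (concat (map block′ ps))
length-shiftedBlocks M [] = refl
length-shiftedBlocks M ((a , k) ∷ ps) rewrite shiftedBlocks-∷ M a k ps
  | length-++ (block (a + M (block a k) (nextBlock ps) + 1) k) {shiftedBlocks M ps}
  | length-++ (block a k) {concat (map block′ ps)}
  | length-interval (suc (a + M (block a k) (nextBlock ps) + 1)) k | length-interval (suc a) k
  = cong suc (cong (k +_) (length-shiftedBlocks M ps))

minimum-nothing : ∀ w → minimum w ≡ nothing → w ≡ []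
minimum-nothing [] _ = refl
minimum-nothing (y ∷ w) e with minimum w
minimum-nothing (y ∷ w) () | nothing
minimum-nothing (y ∷ w) () | just _

minimum-just : ∀ w {m} → minimum w ≡ just m → m ∈ w × All (m ≤_) w
minimum-just (x ∷ w) e with minimum w in e2
minimum-just (x ∷ w) refl | nothing with minimum-nothing w e2
... | refl = here refl , ≤-refl ∷ []
minimum-just (x ∷ w) e | just m' with minimum-just w e2 | x <ᵇ m' in lt
minimum-just (x ∷ w) refl | just m' | (mm , al) | true =
  here refl , ≤-refl ∷ All.map (λ p → <⇒≤ (<-≤-trans (<ᵇ≡true⇒< lt) p)) al
minimum-just (x ∷ w) refl | just m' | (mm , al) | false = there mm , <ᵇ≡false⇒≥ lt ∷ al

minimum-∈ : ∀ w {x} → x ∈ w → Σ[ m ∈ ℕ ] minimum w ≡ just m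
minimum-∈ w {x} mx with minimum w in e
... | just m = m , refl
... | nothing with minimum-nothing w e
minimum-∈ .[] () | nothing | refl

splitMin-just : ∀ w m → minimum w ≡ just m → splitMin w ≡
  (takeWhileᵇ (λ x → not (x ≡ᵇ m)) w , drop 1 (dropWhileᵇ (λ x → not (x ≡ᵇ m)) w))
splitMin-just w m e rewrite e = refl

length-dropWhileᵇ : ∀ (p : ℕ → Bool) w → length (dropWhileᵇ p w) ≤ length w
length-dropWhileᵇ p [] = z≤n
length-dropWhileᵇ p (x ∷ w) with p x
... | true = m≤n⇒m≤1+n (length-dropWhileᵇ p w)
... | false = ≤-refl

length-filterᵇ-splitMin : ∀ (q : ℕ → Bool) w → length (filterᵇ q (proj₂ (splitMin w))) ≤ length w ∸ 1
length-filterᵇ-splitMin q w with minimum w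
... | nothing = z≤n
... | just m = ≤-trans (length-filterᵇ q (drop 1 (dropWhileᵇ (λ x → not (x ≡ᵇ m)) w)))
   (≤-trans (≤-reflexive (length-drop 1 (dropWhileᵇ (λ x → not (x ≡ᵇ m)) w)))
     (∸-monoˡ-≤ 1 (length-dropWhileᵇ (λ x → not (x ≡ᵇ m)) w)))

takeWhile-before : ∀ z A B → z ∉ A → takeWhileᵇ (λ x → not (x ≡ᵇ z)) (A ++ z ∷ B) ≡ A
takeWhile-before z [] B nz rewrite ≡ᵇ≡true {z} {z} refl = refl
takeWhile-before z (a ∷ A) B nz with not (a ≡ᵇ z) in e
... | true = cong (a ∷_) (takeWhile-before z A B (λ m → nz (there m)))
... | false = ⊥-elim (nz (here (sym (≡ᵇ≡true⇒≡ (not-injective e)))))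

dropWhile-after : ∀ z A B → z ∉ A → drop 1 (dropWhileᵇ (λ x → not (x ≡ᵇ z)) (A ++ z ∷ B)) ≡ B
dropWhile-after z [] B nz rewrite ≡ᵇ≡true {z} {z} refl = refl
dropWhile-after z (a ∷ A) B nz with not (a ≡ᵇ z) in e
... | true = dropWhile-after z A B (λ m → nz (there m))
... | false = ⊥-elim (nz (here (sym (≡ᵇ≡true⇒≡ (not-injective e)))))

-- Permutations and the pattern 2-41-3

record PermutationFacts (n : ℕ) (π : List ℕ) : Set where
  field
    uniq : Unique π
    mem⁻ : ∀ {x} → x ∈ π → 1 ≤ x × x ≤ n
    mem⁺ : ∀ {x} → 1 ≤ x → x ≤ n → x ∈ π
    len : length π ≡ n

permutationFacts : ∀ n π → IsPerm n π → PermutationFacts n π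
permutationFacts n π p = record
  { uniq = Unique-resp-↭ (↭⇒↭ₛ (↭-sym p))
      (increasing⇒unique (subst (Increasing) (sym (range≡interval n)) (interval-increasing 1 n)))
  ; mem⁻ = λ m → let (a , b) = ∈-interval⁻ 1 n (subst (_ ∈_) (range≡interval n) (∈-resp-↭ p m)) in a , ≤-pred b
  ; mem⁺ = λ a b → ∈-resp-↭ (↭-sym p) (subst (_ ∈_) (sym (range≡interval n)) (∈-interval⁺ 1 n a (s≤s b)))
  ; len = trans (↭-length p) (trans (cong length (range≡interval n)) (length-interval 1 n))
  }

split-at-index : ∀ (l : List ℕ) (i : Fin (length l)) →
  Σ[ A ∈ List ℕ ] Σ[ B ∈ List ℕ ] (l ≡ A ++ (l ! i) ∷ B × (∀ (j : Fin (length l)) → i <ᶠ j → l ! j ∈ B))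
split-at-index (x ∷ l) zero = [] , l , refl , later
  where
  later : ∀ (j : Fin (length (x ∷ l))) → (Fin.zero {length l}) <ᶠ j → (x ∷ l) ! j ∈ l
  later (suc j) _ = ∈-lookup j
split-at-index (x ∷ l) (suc i) with split-at-index l i
... | A , B , e , lt = x ∷ A , B , cong (x ∷_) e , later
  where
  later : ∀ (j : Fin (length (x ∷ l))) → suc i <ᶠ j → (x ∷ l) ! j ∈ B
  later (suc j) (s≤s p) = lt j p

index-of : ∀ (P Q : List ℕ) (x : ℕ) → Σ[ i ∈ Fin (length (P ++ x ∷ Q)) ] (toℕ i ≡ length P × (P ++ x ∷ Q) ! i ≡ x)
index-of [] Q x = zero , refl , refl
index-of (y ∷ P) Q x with index-of P Q x
... | i , e1 , e2 = suc i , cong suc e1 , e2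

index-of-≡ : ∀ (l P Q : List ℕ) (x : ℕ) → l ≡ P ++ x ∷ Q → Σ[ i ∈ Fin (length l) ] (toℕ i ≡ length P × l ! i ≡ x)
index-of-≡ .(P ++ x ∷ Q) P Q x refl = index-of P Q x

no-2-41-3 : ∀ (l P1 P2 P3 P4 : List ℕ) (a p q z : ℕ) → Avoids2-41-3 l →
  l ≡ P1 ++ a ∷ P2 ++ p ∷ q ∷ P3 ++ z ∷ P4 → q < a → a < z → z < p → ⊥
no-2-41-3 l P1 P2 P3 P4 a p q z av e qa az zp =
  av i j j' k lij jk' jk (subst₂ _<_ (sym ej') (sym ei) qa
    , subst₂ _<_ (sym ei) (sym ek) az , subst₂ _<_ (sym ek) (sym ej) zp)
  where
  Pj = P1 ++ a ∷ P2
  Pj' = Pj ++ [ p ]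
  Pk = Pj' ++ q ∷ P3
  e1 : l ≡ P1 ++ a ∷ (P2 ++ p ∷ q ∷ P3 ++ z ∷ P4)
  e1 = e
  e2 : l ≡ Pj ++ p ∷ (q ∷ P3 ++ z ∷ P4)
  e2 = trans e (sym (++-assoc P1 (a ∷ P2) (p ∷ q ∷ P3 ++ z ∷ P4)))
  e3 : l ≡ Pj' ++ q ∷ (P3 ++ z ∷ P4)
  e3 = trans e2 (sym (++-assoc Pj [ p ] (q ∷ P3 ++ z ∷ P4)))
  e4 : l ≡ Pk ++ z ∷ P4
  e4 = trans e3 (sym (++-assoc Pj' (q ∷ P3) (z ∷ P4)))
  I = index-of-≡ l P1 (P2 ++ p ∷ q ∷ P3 ++ z ∷ P4) a e1
  Jj = index-of-≡ l Pj (q ∷ P3 ++ z ∷ P4) p e2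
  J' = index-of-≡ l Pj' (P3 ++ z ∷ P4) q e3
  Kk = index-of-≡ l Pk P4 z e4
  i = proj₁ I
  j = proj₁ Jj
  j' = proj₁ J'
  k = proj₁ Kk
  ei = proj₂ (proj₂ I)
  ej = proj₂ (proj₂ Jj)
  ej' = proj₂ (proj₂ J')
  ek = proj₂ (proj₂ Kk)
  lPj : length Pj ≡ length P1 + suc (length P2)
  lPj = length-++ P1
  lPj' : length Pj' ≡ suc (length Pj)
  lPj' = trans (length-++ Pj) (+-comm (length Pj) 1)
  lPk : length Pk ≡ length Pj' + suc (length P3)
  lPk = length-++ Pj'
  lij : i <ᶠ j
  lij = subst₂ _<_ (sym (proj₁ (proj₂ I))) (sym (proj₁ (proj₂ Jj)))
          (subst (length P1 <_) (sym lPj)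
            (≤-trans (s≤s (m≤m+n (length P1) (length P2))) (≤-reflexive (sym (+-suc (length P1) (length P2))))))
  jk' : toℕ j' ≡ suc (toℕ j)
  jk' = trans (proj₁ (proj₂ J')) (trans lPj' (cong suc (sym (proj₁ (proj₂ Jj)))))
  jk : j' <ᶠ k
  jk = subst₂ _<_ (sym (proj₁ (proj₂ J'))) (sym (proj₁ (proj₂ Kk)))
         (subst (length Pj' <_) (sym lPk)
            (≤-trans (s≤s (m≤m+n (length Pj') (length P3))) (≤-reflexive (sym (+-suc (length Pj') (length P3))))))

find-descent : ∀ (t y0 : ℕ) (ys : List ℕ) → ¬ (y0 < t) → ∀ {x} → x ∈ ys → x < t →
  Σ[ X ∈ List ℕ ] Σ[ p ∈ ℕ ] Σ[ q ∈ ℕ ] Σ[ Y ∈ List ℕ ]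
    (y0 ∷ ys ≡ X ++ p ∷ q ∷ Y × ¬ (p < t) × q < t × p ∈ y0 ∷ ys)
find-descent t y0 (y1 ∷ ys) n0 m xt with y1 <? t
... | yes lt = [] , y0 , y1 , ys , refl , n0 , lt , here refl
... | no nl with m
... | here refl = ⊥-elim (nl xt)
... | there m' with find-descent t y1 ys nl m' xt
... | X , p , q , Y , e , np , qt , pm = y0 ∷ X , p , q , Y , cong (y0 ∷_) e , np , qt , there pm

-- The word n τ₁ steps from p ≥ a down to q < a somewhere, and then a, p q, z is an occurrence of 2-41-3.
no-small-letter-before-z : ∀ (π σ τ1 τ2 : List ℕ) (n a z x : ℕ) → Avoids2-41-3 π →
  π ≡ σ ++ n ∷ τ1 ++ z ∷ τ2 →
  a ∈ σ → x ∈ τ1 → x < a → a < n → a < z → (∀ {p} → p ∈ τ1 → a < p → z < p) → z < n →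
  (∀ {p} → p ∈ τ1 → p ≢ a) → ⊥
no-small-letter-before-z π σ τ1 τ2 n a z x av eq aσ xm xa an az hz zn pa
  with find-descent a n τ1 (λ lt → <-irrefl refl (<-trans lt an)) xm xa
... | X , p , q , Y , e , np , qa , pm with ∈-∃++ aσ
... | σa , σb , eσs = no-2-41-3 π σa (σb ++ X) Y τ2 a p q z av eqf qa az z<p
    where
    T' : List ℕ
    T' = p ∷ q ∷ Y ++ z ∷ τ2
    eqf : π ≡ σa ++ a ∷ (σb ++ X) ++ p ∷ q ∷ Y ++ z ∷ τ2
    eqf = trans eq (trans (cong (λ l → σ ++ l ++ z ∷ τ2) e)
           (trans (cong (σ ++_) (++-assoc X (p ∷ q ∷ Y) (z ∷ τ2)))
           (trans (cong (_++ (X ++ T')) eσs)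
           (trans (++-assoc σa (a ∷ σb) (X ++ T'))
           (cong (λ l → σa ++ a ∷ l) (sym (++-assoc σb X T')))))))
    zp : ∀ {p} → p ∈ n ∷ τ1 → ¬ (p < a) → z < p
    zp (here refl) _ = zn
    zp (there pτ1) np = hz pτ1 (≤∧≢⇒< (≮⇒≥ np) (λ ea → pa pτ1 (sym ea)))
    z<p : z < p
    z<p = zp pm np

-- ψ on an avoider split as σ n τ

module Split (n : ℕ) (π σ τ : List ℕ) (2≤n : 2 ≤ n) (perm : PermutationFacts n π) (avoids : Avoids2-41-3 π)
  (π≡σnτ : π ≡ σ ++ n ∷ τ) (σ≢[] : σ ≢ []) (n-1∈τ : (n ∸ 1) ∈ τ) where

  -- In the notation of ψ: c = min σ, σ₁ = [c, a] is the lowest block of σ, σ₂ the next one,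
  -- z = 0̂₁ the minimum of w₁, and τ = τ₁ z τ₂ with u = u₁, v = v₁.
  open PermutationFacts perm

  π-unique : Unique (σ ++ n ∷ τ)
  π-unique = subst Unique π≡σnτ uniq

  σ-unique : Unique σ
  σ-unique = unique-++⁻ˡ σ (n ∷ τ) π-unique

  τ-unique : Unique τ
  τ-unique = unique-++⁻ʳ [ n ] τ (unique-++⁻ʳ σ (n ∷ τ) π-unique)

  n∉σ : n ∉ σ
  n∉σ m = unique-++-disjoint σ (n ∷ τ) π-unique m (here refl)

  n∉τ : n ∉ τ
  n∉τ = unique-head (unique-++⁻ʳ σ (n ∷ τ) π-unique)

  σ-τ-disjoint : ∀ {x} → x ∈ σ → x ∈ τ → ⊥
  σ-τ-disjoint x∈σ x∈τ = unique-++-disjoint σ (n ∷ τ) π-unique x∈σ (there x∈τ)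

  ∈π-bounds : ∀ {x} → x ∈ σ ++ n ∷ τ → x ≢ n → 1 ≤ x × x ≤ n ∸ 1
  ∈π-bounds m ne with mem⁻ (subst (_ ∈_) (sym π≡σnτ) m)
  ... | a , b = a , ∸-monoˡ-≤ 1 (≤∧≢⇒< b ne)

  n-1<n : n ∸ 1 < n
  n-1<n = n∸1<n (≤-trans (s≤s z≤n) 2≤n)

  ∈σ-bounds : ∀ {x} → x ∈ σ → 1 ≤ x × x ≤ n ∸ 1
  ∈σ-bounds m = ∈π-bounds (∈-++⁺ˡ m) (λ e → n∉σ (subst (_∈ σ) e m))

  ∈τ-bounds : ∀ {x} → x ∈ τ → 1 ≤ x × x ≤ n ∸ 1
  ∈τ-bounds m = ∈π-bounds (∈-++⁺ʳ σ (there m)) (λ e → n∉τ (subst (_∈ τ) e m))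

  ∈σ⊎∈τ : ∀ {x} → 1 ≤ x → x ≤ n ∸ 1 → x ∈ σ ⊎ x ∈ τ
  ∈σ⊎∈τ a b with ∈-++⁻ σ (subst (_ ∈_) π≡σnτ (mem⁺ a (≤-trans b (<⇒≤ n-1<n))))
  ... | inj₁ m = inj₁ m
  ... | inj₂ (here refl) = ⊥-elim (<-irrefl refl (≤-<-trans b n-1<n))
  ... | inj₂ (there m) = inj₂ m

  length-σ+τ : length σ + length τ ≡ n ∸ 1
  length-σ+τ = cong (_∸ 1) (trans (sym (+-suc (length σ) (length τ)))
    (trans (sym (length-++ σ)) (trans (cong length (sym π≡σnτ)) len)))

  Psi-σ≡σ : Psi.σ n π ≡ σ
  Psi-σ≡σ = trans (cong (takeWhileᵇ (λ x → not (x ≡ᵇ n))) π≡σnτ) (takeWhile-before n σ τ n∉σ)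

  Psi-τ≡τ : Psi.τ n π ≡ τ
  Psi-τ≡τ = trans (cong (λ l → drop 1 (dropWhileᵇ (λ x → not (x ≡ᵇ n)) l)) π≡σnτ) (dropWhile-after n σ τ n∉σ)

  sort-σ-increasing : Increasing (sort σ)
  sort-σ-increasing = sort-increasing σ σ-unique

  opaque
    firstBlock : Σ[ c ∈ ℕ ] Σ[ k ∈ ℕ ] Σ[ laterBlocks ∈ List (ℕ × ℕ) ]
          (runs (sort σ) ≡ map block′ ((c , k) ∷ laterBlocks)
          × concat (map block′ ((c , k) ∷ laterBlocks)) ≡ sort σ
          × Separated ((c , k) ∷ laterBlocks))
    firstBlock with runs-sorted (sort σ) sort-σ-increasing
    ... | (c , k) ∷ laterBlocks , e1 , e2 , g = c , k , laterBlocks , e1 , e2 , g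
    ... | [] , e1 , e2 , g = ⊥-elim (σ≢[] (length≡0⇒≡[] σ (trans (sym (length-sort σ)) (cong length (sym e2)))))
      where
      length≡0⇒≡[] : ∀ (l : List ℕ) → length l ≡ 0 → l ≡ []
      length≡0⇒≡[] [] _ = refl

    c : ℕ
    c = proj₁ firstBlock
    k : ℕ
    k = proj₁ (proj₂ firstBlock)
    laterBlocks : List (ℕ × ℕ)
    laterBlocks = proj₁ (proj₂ (proj₂ firstBlock))
    runs-sort-σ : runs (sort σ) ≡ map block′ ((c , k) ∷ laterBlocks)
    runs-sort-σ = proj₁ (proj₂ (proj₂ (proj₂ firstBlock)))
    concat-blocks≡sort-σ : concat (map block′ ((c , k) ∷ laterBlocks)) ≡ sort σ
    concat-blocks≡sort-σ = proj₁ (proj₂ (proj₂ (proj₂ (proj₂ firstBlock))))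
    blocks-separated : Separated ((c , k) ∷ laterBlocks)
    blocks-separated = proj₂ (proj₂ (proj₂ (proj₂ (proj₂ firstBlock))))

  blocks : List (ℕ × ℕ)
  blocks = (c , k) ∷ laterBlocks

  a : ℕ
  a = c + k
  σ₁ : List ℕ
  σ₁ = block c k
  σ₂ : List ℕ
  σ₂ = nextBlock laterBlocks

  ∈blocks⇒∈σ : ∀ {y} → y ∈ concat (map block′ blocks) → y ∈ σ
  ∈blocks⇒∈σ m = ∈-sort⁻ σ (subst (_ ∈_) concat-blocks≡sort-σ m)

  ∈σ⇒∈blocks : ∀ {y} → y ∈ σ → y ∈ concat (map block′ blocks)
  ∈σ⇒∈blocks m = subst (_ ∈_) (sym concat-blocks≡sort-σ) (∈-sort⁺ σ m)

  blocks-increasing : Increasing (concat (map block′ blocks))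
  blocks-increasing = subst (Increasing) (sym concat-blocks≡sort-σ) sort-σ-increasing

  c∈σ : c ∈ σ
  c∈σ = ∈blocks⇒∈σ (here refl)

  c≤σ : ∀ {y} → y ∈ σ → c ≤ y
  c≤σ m with ∈σ⇒∈blocks m | blocks-increasing
  ... | here refl | _ = ≤-refl
  ... | there q | h ∷ _ = <⇒≤ (All.lookup h q)

  ∈σ₁⇒∈σ : ∀ {y} → y ∈ σ₁ → y ∈ σ
  ∈σ₁⇒∈σ m = ∈blocks⇒∈σ (∈-++⁺ˡ m)

  a∈σ : a ∈ σ
  a∈σ = ∈σ₁⇒∈σ (∈-block⁺ c k (m≤m+n c k) ≤-refl)

  σ-shape : ∀ {y} → y ∈ σ → (c ≤ y × y ≤ a) ⊎ suc a < y
  σ-shape m with ∈-++⁻ σ₁ (∈σ⇒∈blocks m)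
  ... | inj₁ q = inj₁ (∈-block⁻ c k q)
  ... | inj₂ q = inj₂ (separated-above c k laterBlocks blocks-separated q)

  c≤∉σ⇒a< : ∀ {x} → c ≤ x → x ∉ σ → a < x
  c≤∉σ⇒a< {x} cx nx with x ≤? a
  ... | yes le = ⊥-elim (nx (∈σ₁⇒∈σ (∈-block⁺ c k cx le)))
  ... | no nl = ≰⇒> nl

  a+1∉σ : suc a ∉ σ
  a+1∉σ m with σ-shape m
  ... | inj₁ (_ , le) = <-irrefl refl le
  ... | inj₂ lt = <-irrefl refl lt

  σ₂-above-a+1 : ∀ {y} → y ∈ σ₂ → suc a < y
  σ₂-above-a+1 {y} m = separated-above c k laterBlocks blocks-separated (lem laterBlocks m)
    where
    lem : ∀ qs → y ∈ nextBlock qs → y ∈ concat (map block′ qs)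
    lem (q ∷ qs) m = ∈-++⁺ˡ m

  a<n-1 : a < n ∸ 1
  a<n-1 = ≤∧≢⇒< (proj₂ (∈σ-bounds a∈σ)) (λ e → σ-τ-disjoint a∈σ (subst (_∈ τ) (sym e) n-1∈τ))

  inw₁ : ℕ → Bool
  inw₁ x = (σ₁ ≺ᵇ (x ∷ [])) ∧ ((x ∷ []) ≺ᵇ σ₂)

  inw₁⁻ : ∀ {x} → inw₁ x ≡ true → a < x × (∀ {y} → y ∈ σ₂ → x < y)
  inw₁⁻ {x} e with ∧≡true⁻ {σ₁ ≺ᵇ (x ∷ [])} e
  ... | p , q = ≺ᵇ[]⁻ σ₁ x p (∈-block⁺ c k (m≤m+n c k) ≤-refl) , []≺ᵇ⁻ σ₂ x q

  inw₁⁺ : ∀ {x} → a < x → (∀ {y} → y ∈ σ₂ → x < y) → inw₁ x ≡ true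
  inw₁⁺ {x} ax h = ∧≡true⁺ (≺ᵇ[]⁺ σ₁ x (λ m → ≤-<-trans (proj₂ (∈-block⁻ c k m)) ax)) ([]≺ᵇ⁺ σ₂ x h)

  inw₁≡false⁻ : ∀ {x} → a < x → inw₁ x ≡ false → Σ[ b ∈ ℕ ] (b ∈ σ₂ × b ≤ x)
  inw₁≡false⁻ {x} ax e = []≺ᵇ-false⁻ σ₂ x
    (trans (sym (cong (_∧ ((x ∷ []) ≺ᵇ σ₂)) (≺ᵇ[]⁺ σ₁ x (λ m → ≤-<-trans (proj₂ (∈-block⁻ c k m)) ax)))) e)

  w₁ : List ℕ
  w₁ = filterᵇ inw₁ τ

  Psi-w≡w₁ : Psi.w n π σ₁ σ₂ ≡ w₁
  Psi-w≡w₁ = cong (filterᵇ inw₁) Psi-τ≡τ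

  a+1∈τ : suc a ∈ τ
  a+1∈τ with ∈σ⊎∈τ {suc a} (s≤s z≤n) a<n-1
  ... | inj₁ m = ⊥-elim (a+1∉σ m)
  ... | inj₂ m = m

  a+1∈w₁ : suc a ∈ w₁
  a+1∈w₁ = ∈-filterᵇ⁺ inw₁ τ a+1∈τ (inw₁⁺ ≤-refl σ₂-above-a+1)

  opaque
    minimum-w₁ : Σ[ m ∈ ℕ ] minimum w₁ ≡ just m
    minimum-w₁ = minimum-∈ w₁ a+1∈w₁

    z : ℕ
    z = proj₁ minimum-w₁

    minimum-w₁≡z : minimum w₁ ≡ just z
    minimum-w₁≡z = proj₂ minimum-w₁

  z∈w₁ : z ∈ w₁
  z∈w₁ = proj₁ (minimum-just w₁ minimum-w₁≡z)

  z≤w₁ : ∀ {y} → y ∈ w₁ → z ≤ y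
  z≤w₁ m = All.lookup (proj₂ (minimum-just w₁ minimum-w₁≡z)) m

  z∈τ : z ∈ τ
  z∈τ = proj₁ (∈-filterᵇ⁻ inw₁ τ z∈w₁)

  inw₁-z : inw₁ z ≡ true
  inw₁-z = proj₂ (∈-filterᵇ⁻ inw₁ τ z∈w₁)

  a<z : a < z
  a<z = proj₁ (inw₁⁻ inw₁-z)

  opaque
    τ-split : Σ[ τ₁ ∈ List ℕ ] Σ[ τ₂ ∈ List ℕ ] τ ≡ τ₁ ++ [ z ] ++ τ₂
    τ-split = ∈-∃++ z∈τ

    τ₁ : List ℕ
    τ₁ = proj₁ τ-split
    τ₂ : List ℕ
    τ₂ = proj₁ (proj₂ τ-split)
    τ≡τ₁zτ₂ : τ ≡ τ₁ ++ z ∷ τ₂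
    τ≡τ₁zτ₂ = proj₂ (proj₂ τ-split)

  τ-split-unique : Unique (τ₁ ++ z ∷ τ₂)
  τ-split-unique = subst Unique τ≡τ₁zτ₂ τ-unique

  z∉τ₁ : z ∉ τ₁
  z∉τ₁ m = unique-++-disjoint τ₁ (z ∷ τ₂) τ-split-unique m (here refl)

  z∉τ₂ : z ∉ τ₂
  z∉τ₂ = unique-head (unique-++⁻ʳ τ₁ (z ∷ τ₂) τ-split-unique)

  ∈τ₁⇒∈τ : ∀ {x} → x ∈ τ₁ → x ∈ τ
  ∈τ₁⇒∈τ m = subst (_ ∈_) (sym τ≡τ₁zτ₂) (∈-++⁺ˡ m)

  ∈τ₂⇒∈τ : ∀ {x} → x ∈ τ₂ → x ∈ τ
  ∈τ₂⇒∈τ m = subst (_ ∈_) (sym τ≡τ₁zτ₂) (∈-++⁺ʳ τ₁ (there m))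

  u : List ℕ
  u = filterᵇ inw₁ τ₁
  v : List ℕ
  v = filterᵇ inw₁ τ₂

  w₁≡u++z∷v : w₁ ≡ u ++ z ∷ v
  w₁≡u++z∷v = trans (cong (filterᵇ inw₁) τ≡τ₁zτ₂)
    (trans (filter-++ (T? ∘ inw₁) τ₁ (z ∷ τ₂)) (cong (u ++_) (filterᵇ-accept inw₁ z τ₂ inw₁-z)))

  z∉u : z ∉ u
  z∉u m = z∉τ₁ (proj₁ (∈-filterᵇ⁻ inw₁ τ₁ m))

  splitMin-w₁ : splitMin w₁ ≡ (u , v)
  splitMin-w₁ = trans (splitMin-just w₁ z minimum-w₁≡z)
    (cong₂ _,_ (trans (cong (takeWhileᵇ (λ x → not (x ≡ᵇ z))) w₁≡u++z∷v) (takeWhile-before z u v z∉u))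
               (trans (cong (λ l → drop 1 (dropWhileᵇ (λ x → not (x ≡ᵇ z)) l)) w₁≡u++z∷v)
               (dropWhile-after z u v z∉u)))

  mᵢ : List ℕ → List ℕ → ℕ
  mᵢ = Psi.mᵢ n π

  m₁ : ℕ
  m₁ = mᵢ σ₁ σ₂

  v≺u : List ℕ
  v≺u = filterᵇ (λ x → (x ∷ []) ≺ᵇ u) v

  m₁≡length-v≺u : m₁ ≡ length v≺u
  m₁≡length-v≺u = cong F (trans (cong splitMin Psi-w≡w₁) splitMin-w₁)
    where
    F : List ℕ × List ℕ → ℕ
    F uv = length (filterᵇ (λ x → (x ∷ []) ≺ᵇ proj₁ uv) (proj₂ uv))

  c≤a : c ≤ a
  c≤a = m≤m+n c k

  1≤c : 1 ≤ c
  1≤c = proj₁ (∈σ-bounds c∈σ)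

  1+[c∸1]≡c : 1 + (c ∸ 1) ≡ c
  1+[c∸1]≡c = trans (+-comm 1 (c ∸ 1)) (m∸n+n≡m 1≤c)

  z≤τ-above-c : ∀ {x} → x ∈ τ → c ≤ x → z ≤ x
  z≤τ-above-c {x} xτ cx with inw₁ x in e
  ... | true = z≤w₁ (∈-filterᵇ⁺ inw₁ τ xτ e)
  ... | false with inw₁≡false⁻ (c≤∉σ⇒a< cx (λ m → σ-τ-disjoint m xτ)) e
  ... | b , bB2 , bx = <⇒≤ (<-≤-trans (proj₂ (inw₁⁻ inw₁-z) bB2) bx)

  z<n : z < n
  z<n = ≤-<-trans (proj₂ (∈τ-bounds z∈τ)) n-1<n

  τ₁-above-c : ∀ {x} → x ∈ τ₁ → c ≤ x
  τ₁-above-c {x} xm with c ≤? x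
  ... | yes le = le
  ... | no nl = ⊥-elim (no-small-letter-before-z π σ τ₁ τ₂ n a z x avoids eq1 a∈σ xm
                  (<-≤-trans (≰⇒> nl) c≤a)
                  (≤-<-trans (proj₂ (∈σ-bounds a∈σ)) n-1<n) a<z hz z<n pa)
    where
    eq1 : π ≡ σ ++ n ∷ τ₁ ++ z ∷ τ₂
    eq1 = trans π≡σnτ (cong (λ t → σ ++ n ∷ t) τ≡τ₁zτ₂)
    hz : ∀ {p} → p ∈ τ₁ → a < p → z < p
    hz pτ1 ap = ≤∧≢⇒< (z≤τ-above-c (∈τ₁⇒∈τ pτ1) (≤-trans c≤a (<⇒≤ ap)))
      (λ ez → z∉τ₁ (subst (_∈ τ₁) (sym ez) pτ1))
    pa : ∀ {p} → p ∈ τ₁ → p ≢ a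
    pa pτ1 ea = σ-τ-disjoint a∈σ (subst (_∈ τ) ea (∈τ₁⇒∈τ pτ1))

  countBelow-τ-≤ : ∀ x t → 1 ≤ t → (∀ {y} → y ∈ τ → y < x → y < t) → countBelow τ x ≤ t ∸ 1
  countBelow-τ-≤ x t t1 h = unique⊆interval⇒length≤ _ 1 (t ∸ 1) (filterᵇ-unique (λ y → y <ᵇ x) τ-unique) f
    where
    f : ∀ {y} → y ∈ filterᵇ (λ y → y <ᵇ x) τ → 1 ≤ y × y < 1 + (t ∸ 1)
    f m with ∈-filterᵇ⁻ (λ y → y <ᵇ x) τ m
    ... | mτ , lt = proj₁ (∈τ-bounds mτ) ,
        subst (_ <_) (sym (trans (+-comm 1 (t ∸ 1)) (m∸n+n≡m t1))) (h mτ (<ᵇ≡true⇒< lt))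

  countBelow-τ-self : ∀ {x} → x ∈ τ → countBelow τ x ≤ x ∸ 1
  countBelow-τ-self {x} xτ = countBelow-τ-≤ x x (proj₁ (∈τ-bounds xτ)) (λ _ lt → lt)

  countBelow-τ-z : countBelow τ z ≤ c ∸ 1
  countBelow-τ-z = countBelow-τ-≤ z c 1≤c
    (λ {y} yτ lt → ≰⇒> (λ cy → <-irrefl refl (<-≤-trans lt (z≤τ-above-c yτ cy))))

  τ₂-unique : Unique τ₂
  τ₂-unique = unique-++⁻ʳ [ z ] τ₂ (unique-++⁻ʳ τ₁ (z ∷ τ₂) τ-split-unique)

  ∈v≺u⁻ : ∀ {y} → y ∈ v≺u → y ∈ v × ((y ∷ []) ≺ᵇ u) ≡ true
  ∈v≺u⁻ m = ∈-filterᵇ⁻ (λ x → (x ∷ []) ≺ᵇ u) v m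

  ∈v⁻ : ∀ {y} → y ∈ v → y ∈ τ₂ × inw₁ y ≡ true
  ∈v⁻ m = ∈-filterᵇ⁻ inw₁ τ₂ m

  ∈τ-below-c : ∀ {y} → 1 ≤ y → y < c → y ∈ τ
  ∈τ-below-c 1≤y y<c with ∈σ⊎∈τ 1≤y (<⇒≤ (<-trans (<-≤-trans y<c c≤a) a<n-1))
  ... | inj₁ y∈σ = ⊥-elim (<⇒≱ y<c (c≤σ y∈σ))
  ... | inj₂ y∈τ = y∈τ

  ∈v≺u⇒∈τ₂ : ∀ {y} → y ∈ v≺u → y ∈ τ₂
  ∈v≺u⇒∈τ₂ = proj₁ ∘ ∈v⁻ ∘ proj₁ ∘ ∈v≺u⁻

  ∈v≺u⇒a< : ∀ {y} → y ∈ v≺u → a < y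
  ∈v≺u⇒a< = proj₁ ∘ inw₁⁻ ∘ proj₂ ∘ ∈v⁻ ∘ proj₁ ∘ ∈v≺u⁻

  ∈τ₁⇒a< : ∀ {x} → x ∈ τ₁ → a < x
  ∈τ₁⇒a< x∈τ₁ = c≤∉σ⇒a< (τ₁-above-c x∈τ₁) (λ x∈σ → σ-τ-disjoint x∈σ (∈τ₁⇒∈τ x∈τ₁))

  ∈τ₁⇒z< : ∀ {x} → x ∈ τ₁ → z < x
  ∈τ₁⇒z< x∈τ₁ = ≤∧≢⇒< (z≤τ-above-c (∈τ₁⇒∈τ x∈τ₁) (τ₁-above-c x∈τ₁))
    (λ e → z∉τ₁ (subst (_∈ τ₁) (sym e) x∈τ₁))

  -- If x ∈ w₁ then x ∈ u; otherwise x lies above a letter of σ₂, and σ₂ bounds w₁.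
  v≺u<τ₁ : ∀ {x y} → x ∈ τ₁ → y ∈ v≺u → y < x
  v≺u<τ₁ {x} {y} x∈τ₁ y∈v≺u with inw₁ x in e
  ... | true = []≺ᵇ⁻ u y (proj₂ (∈v≺u⁻ y∈v≺u)) (∈-filterᵇ⁺ inw₁ τ₁ x∈τ₁ e)
  ... | false with inw₁≡false⁻ (∈τ₁⇒a< x∈τ₁) e
  ... | b , b∈σ₂ , b≤x = <-≤-trans (proj₂ (inw₁⁻ (proj₂ (∈v⁻ (proj₁ (∈v≺u⁻ y∈v≺u)))))
      b∈σ₂) b≤x

  below-τ₁ : List ℕ
  below-τ₁ = interval 1 (c ∸ 1) ++ z ∷ v≺u

  length-below-τ₁ : length below-τ₁ ≡ c + m₁
  length-below-τ₁ = begin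
    length (interval 1 (c ∸ 1) ++ z ∷ v≺u)        ≡⟨ length-++ (interval 1 (c ∸ 1)) ⟩
    length (interval 1 (c ∸ 1)) + suc (length v≺u) ≡⟨ cong (_+ suc (length v≺u)) (length-interval 1 (c ∸ 1)) ⟩
    c ∸ 1 + suc (length v≺u)                       ≡⟨ +-suc (c ∸ 1) (length v≺u) ⟩
    suc (c ∸ 1) + length v≺u                       ≡⟨ cong₂ _+_ 1+[c∸1]≡c (sym m₁≡length-v≺u) ⟩
    c + m₁                                         ∎
    where open ≡-Reasoning

  below-τ₁-unique : Unique below-τ₁
  below-τ₁-unique = UP.++⁺ (increasing⇒unique (interval-increasing 1 (c ∸ 1))) z∷v≺u-unique
    (λ (y∈interval , y∈z∷v≺u) → <-asym (<-≤-trans (proj₂ (∈-interval⁻ 1 (c ∸ 1) y∈interval))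
        (≤-trans (≤-reflexive (1+[c∸1]≡c)) c≤a)) (a<z∷v≺u y∈z∷v≺u))
    where
    z∷v≺u-unique : Unique (z ∷ v≺u)
    z∷v≺u-unique = All.tabulate (λ y∈v≺u z≡y → z∉τ₂ (subst (_∈ τ₂) (sym z≡y) (∈v≺u⇒∈τ₂ y∈v≺u)))
      ∷ filterᵇ-unique _ (filterᵇ-unique inw₁ τ₂-unique)
    a<z∷v≺u : ∀ {y} → y ∈ z ∷ v≺u → a < y
    a<z∷v≺u (here refl) = a<z
    a<z∷v≺u (there y∈v≺u) = ∈v≺u⇒a< y∈v≺u

  below-τ₁-below : ∀ {x y} → x ∈ τ₁ → y ∈ below-τ₁ → y ∈ filterᵇ (_<ᵇ x) τ
  below-τ₁-below {x} {y} x∈τ₁ y∈ with ∈-++⁻ (interval 1 (c ∸ 1)) y∈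
  ... | inj₁ y∈interval = ∈-filterᵇ⁺ _ τ (∈τ-below-c 1≤y y<c) (<ᵇ≡true (<-≤-trans y<c (τ₁-above-c x∈τ₁)))
    where
    1≤y = proj₁ (∈-interval⁻ 1 (c ∸ 1) y∈interval)
    y<c = subst (y <_) 1+[c∸1]≡c (proj₂ (∈-interval⁻ 1 (c ∸ 1) y∈interval))
  ... | inj₂ (here refl) = ∈-filterᵇ⁺ _ τ z∈τ (<ᵇ≡true (∈τ₁⇒z< x∈τ₁))
  ... | inj₂ (there y∈v≺u) = ∈-filterᵇ⁺ _ τ (∈τ₂⇒∈τ (∈v≺u⇒∈τ₂ y∈v≺u))
    (<ᵇ≡true (v≺u<τ₁ x∈τ₁ y∈v≺u))

  countBelow-τ₁ : ∀ {x} → x ∈ τ₁ → c + m₁ ≤ countBelow τ x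
  countBelow-τ₁ x∈τ₁ = subst (_≤ _) length-below-τ₁
    (unique⊆⇒length≤ below-τ₁ _ below-τ₁-unique (below-τ₁-below x∈τ₁))

  between : List ℕ → List ℕ → ℕ → Bool
  between B B' x = (B ≺ᵇ (x ∷ [])) ∧ ((x ∷ []) ≺ᵇ B')

  length-w-≤ : ∀ B B' lo d → (∀ {x} → x ∈ τ → between B B' x ≡ true → lo ≤ x × x < lo + d) →
    length (Psi.w n π B B') ≤ d
  length-w-≤ B B' lo d h = subst (λ l → length l ≤ d) (sym (cong (filterᵇ (between B B')) Psi-τ≡τ))
    (unique⊆interval⇒length≤ _ lo d (filterᵇ-unique (between B B') τ-unique)
      (λ m → let (p , q) = ∈-filterᵇ⁻ (between B B') τ m in h p q))

  blocks-fit : ∀ qs → Separated qs → (∀ {y} → y ∈ concat (map block′ qs) → y ∈ σ) → Fits mᵢ (n ∸ 1) qs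
  blocks-fit [] g h = tt
  blocks-fit ((a' , k') ∷ []) g h = +-∸-fit-≤ hi (n ∸ 1) _ hi<
      (≤-trans (length-filterᵇ-splitMin _ (Psi.w n π (block a' k') []))
        (∸-monoˡ-≤ 1 (length-w-≤ (block a' k') [] (suc hi) ((n ∸ 1) ∸ hi) bnd)))
    where
    hi = a' + k'
    hiσ : hi ∈ σ
    hiσ = h (∈-++⁺ˡ (∈-block⁺ a' k' (m≤m+n a' k') ≤-refl))
    hi< : hi < n ∸ 1
    hi< = ≤∧≢⇒< (proj₂ (∈σ-bounds hiσ)) (λ e → σ-τ-disjoint hiσ (subst (_∈ τ) (sym e) n-1∈τ))
    bnd : ∀ {x} → x ∈ τ → between (block a' k') [] x ≡ true → suc hi ≤ x × x < suc hi + ((n ∸ 1) ∸ hi)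
    bnd {x} xτ e = ≺ᵇ[]⁻ (block a' k') x (proj₁ (∧≡true⁻ {block a' k' ≺ᵇ (x ∷ [])} e))
        (∈-block⁺ a' k' (m≤m+n a' k') ≤-refl) ,
      s≤s (≤-trans (proj₂ (∈τ-bounds xτ)) (≤-reflexive (sym (m+[n∸m]≡n (<⇒≤ hi<)))))
  blocks-fit ((a' , k') ∷ (a'' , k'') ∷ qs) (lt , g) h =
    +-∸-fit-< hi a'' _ (<⇒≤ lt)
      (≤-trans (length-filterᵇ-splitMin _ (Psi.w n π (block a' k') (block a'' k'')))
      (≤-trans (m∸n≤m _ 1)
      (length-w-≤ (block a' k') (block a'' k'') (suc hi) (a'' ∸ suc hi) bnd))) ,
    blocks-fit ((a'' , k'') ∷ qs) g (λ m → h (∈-++⁺ʳ (block a' k') m))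
    where
    hi = a' + k'
    bnd : ∀ {x} → x ∈ τ → between (block a' k') (block a'' k'') x ≡ true → suc hi ≤ x × x < suc hi + (a'' ∸ suc hi)
    bnd {x} xτ e with ∧≡true⁻ {block a' k' ≺ᵇ (x ∷ [])} e
    ... | p , q = ≺ᵇ[]⁻ (block a' k') x p (∈-block⁺ a' k' (m≤m+n a' k') ≤-refl) ,
      subst (x <_) (sym (m+[n∸m]≡n (<⇒≤ lt))) ([]≺ᵇ⁻ (block a'' k'') x q (here refl))

  ℓ : ℕ
  ℓ = c + m₁ + 1

  L-shape : Increasing (shiftedBlocks mᵢ blocks) × All (λ y → ℓ ≤ y × y ≤ n ∸ 1) (shiftedBlocks mᵢ blocks) ×
    Σ[ r ∈ List ℕ ] shiftedBlocks mᵢ blocks ≡ ℓ ∷ r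
  L-shape = shiftedBlocks-increasing mᵢ (n ∸ 1) c k laterBlocks (blocks-fit blocks blocks-separated ∈blocks⇒∈σ)

  L : List ℕ
  L = Psi.L n π

  Psi-blocks≡ : Psi.blocks n π ≡ map block′ blocks
  Psi-blocks≡ = trans (cong (λ s → runs (sort s)) Psi-σ≡σ) runs-sort-σ

  Psi-blockPairs≡ : Psi.blockPairs n π ≡ adjacentPairs (map block′ blocks)
  Psi-blockPairs≡ = trans (cong (λ bs → zip bs (drop 1 bs ++ ([] ∷ []))) Psi-blocks≡)
    (zip≡adjacentPairs σ₁ (map block′ laterBlocks))

  L≡shiftedBlocks : L ≡ shiftedBlocks mᵢ blocks
  L≡shiftedBlocks = trans (cong (λ l → sort (concat l))
          (trans (cong (map (Psi.Lᵢ n π)) Psi-blockPairs≡)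
            (map-cong (λ { (B , B') → refl }) (adjacentPairs (map block′ blocks)))))
        (sort-increasing-id (shiftedBlocks mᵢ blocks) (proj₁ L-shape))

  L-increasing : Increasing L
  L-increasing = subst (Increasing) (sym L≡shiftedBlocks) (proj₁ L-shape)

  ∈L-bounds : ∀ {y} → y ∈ L → ℓ ≤ y × y ≤ n ∸ 1
  ∈L-bounds m = All.lookup (proj₁ (proj₂ L-shape)) (subst (_ ∈_) L≡shiftedBlocks m)

  L-head : Σ[ r ∈ List ℕ ] L ≡ ℓ ∷ r
  L-head = proj₁ (proj₂ (proj₂ L-shape)) , trans L≡shiftedBlocks (proj₂ (proj₂ (proj₂ L-shape)))

  length-L : length L ≡ length σ
  length-L = trans (cong length L≡shiftedBlocks)
    (trans (length-shiftedBlocks mᵢ blocks)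
    (trans (cong length concat-blocks≡sort-σ) (length-sort σ)))

  ∉L : ℕ → Bool
  ∉L y = not (y ∈ᵇ L)

  R : List ℕ
  R = Psi.R n π

  R≡filterᵇ : R ≡ filterᵇ ∉L (interval 1 (n ∸ 1))
  R≡filterᵇ = cong (filterᵇ ∉L) (range≡interval (n ∸ 1))

  R-increasing : Increasing R
  R-increasing = subst (Increasing) (sym R≡filterᵇ) (APP.filter⁺ (λ y → T? (∉L y)) (interval-increasing 1 (n ∸ 1)))

  ∈R-bounds : ∀ {y} → y ∈ R → 1 ≤ y × y ≤ n ∸ 1
  ∈R-bounds m with ∈-interval⁻ 1 (n ∸ 1) (proj₁ (∈-filterᵇ⁻ ∉L (interval 1 (n ∸ 1)) (subst (_ ∈_) R≡filterᵇ m)))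
  ... | p , q = p , ≤-pred q

  length-τ≤length-R : length τ ≤ length R
  length-τ≤length-R = +-cancelˡ-≤ (length σ) (length τ) (length R)
    (≤-trans (≤-reflexive E) (+-monoˡ-≤ (length R) Fle))
    where
    F : ℕ
    F = length (filterᵇ (λ y → y ∈ᵇ L) (interval 1 (n ∸ 1)))
    E : length σ + length τ ≡ F + length R
    E = trans length-σ+τ (trans (sym (length-interval 1 (n ∸ 1)))
          (trans (sym (length-filterᵇ-partition (λ y → y ∈ᵇ L) (interval 1 (n ∸ 1))))
          (cong (F +_) (cong length (sym R≡filterᵇ)))))
    Fle : length (filterᵇ (λ y → y ∈ᵇ L) (interval 1 (n ∸ 1))) ≤ length σ
    Fle = ≤-trans (unique⊆⇒length≤ _ L (filterᵇ-unique _ (increasing⇒unique (interval-increasing 1 (n ∸ 1))))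
          (λ m → ∈ᵇ≡true⇒∈ L (proj₂ (∈-filterᵇ⁻ _ (interval 1 (n ∸ 1)) m))))
            (≤-reflexive length-L)

  ℓ∈L : ℓ ∈ L
  ℓ∈L = subst (ℓ ∈_) (sym (proj₂ L-head)) (here refl)

  nth-R-small : ∀ j → suc j < ℓ → nth R (suc j) ≡ suc j
  nth-R-small j lt = trans (cong (λ l → nth l (suc j)) R≡filterᵇ)
    (nth-filterᵇ-interval ∉L 1 (n ∸ 1) j (<-trans (n<1+n j) (<-≤-trans lt (proj₂ (∈L-bounds ℓ∈L))))
      (λ y _ yle → cong not (∉⇒∈ᵇ≡false L
        (λ m → <-irrefl refl (<-≤-trans (≤-<-trans yle lt) (proj₁ (∈L-bounds m)))))))

  nth-R-≥ : ∀ j → suc j ≤ length R → suc j ≤ nth R (suc j)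
  nth-R-≥ j le = nth-≥ 1 R-increasing (All.tabulate (λ m → proj₁ (∈R-bounds m))) j le

  fσ : ℕ → ℕ
  fσ x = nth L (rank σ x)

  fτ : ℕ → ℕ
  fτ x = nth R (rank τ x)

  fσ-preservesOrder : PreservesOrderOn (_∈ σ) fσ
  fσ-preservesOrder = preservesOrderOn-∘ (_∈ σ) (Position L) (rank σ) (nth L)
    (rank-preservesOrderOn σ) (nth-preservesOrderOn L-increasing)
           (λ m → s≤s z≤n , ≤-trans (rank≤length σ m) (≤-reflexive (sym length-L)))

  fτ-preservesOrder : PreservesOrderOn (_∈ τ) fτ
  fτ-preservesOrder = preservesOrderOn-∘ (_∈ τ) (Position R) (rank τ) (nth R)
    (rank-preservesOrderOn τ) (nth-preservesOrderOn R-increasing)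
           (λ m → s≤s z≤n , ≤-trans (rank≤length τ m) length-τ≤length-R)

  fσ∈L : ∀ {x} → x ∈ σ → fσ x ∈ L
  fσ∈L {x} m = nth-∈ L (countBelow σ x) (≤-trans (rank≤length σ m) (≤-reflexive (sym length-L)))

  fτ∈R : ∀ {x} → x ∈ τ → fτ x ∈ R
  fτ∈R {x} m = nth-∈ R (countBelow τ x) (≤-trans (rank≤length τ m) length-τ≤length-R)

  fσ-bounds : ∀ {x} → x ∈ σ → x < n × fσ x < n
  fσ-bounds m = ≤-<-trans (proj₂ (∈σ-bounds m)) n-1<n , ≤-<-trans (proj₂ (∈L-bounds (fσ∈L m))) n-1<n

  fτ-bounds : ∀ {x} → x ∈ τ → x < n × fτ x < n
  fτ-bounds m = ≤-<-trans (proj₂ (∈τ-bounds m)) n-1<n , ≤-<-trans (proj₂ (∈R-bounds (fτ∈R m))) n-1<n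

  fσ-c : fσ c ≡ ℓ
  fσ-c = trans (cong (λ k → nth L (suc k)) (length-filterᵇ-none _ σ (λ m → <ᵇ≡false (≤⇒≯ (c≤σ m)))))
          (cong (λ l → nth l 1) (proj₂ L-head))

  belowσ : ℕ → Bool
  belowσ x = all (λ y → x <ᵇ y) (reverse σ)

  belowσ≡ : ∀ x → belowσ x ≡ (x <ᵇ c)
  belowσ≡ x = trans (all-reverse (λ y → x <ᵇ y) σ) (all-<ᵇ-minimum c x σ c∈σ c≤σ)

  belowψσ : ℕ → Bool
  belowψσ x = all (λ y → fτ x <ᵇ y) (reverse (map fσ σ))

  belowψσ≡ : ∀ x → belowψσ x ≡ (fτ x <ᵇ ℓ)
  belowψσ≡ x = trans (all-reverse (λ y → fτ x <ᵇ y) (map fσ σ))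
    (all-<ᵇ-minimum ℓ (fτ x) (map fσ σ) (subst (_∈ map fσ σ) fσ-c (∈-map⁺ fσ c∈σ)) lb)
    where
    lb : ∀ {y} → y ∈ map fσ σ → ℓ ≤ y
    lb m with ∈-map⁻ fσ m
    ... | x' , m' , refl = proj₁ (∈L-bounds (fσ∈L m'))

  ℓ-eq : ℓ ≡ suc (c + m₁)
  ℓ-eq = +-comm (c + m₁) 1

  belowψσ-τ : ∀ {x} → x ∈ τ → belowψσ x ≡ (countBelow τ x <ᵇ c + m₁)
  belowψσ-τ {x} xτ = trans (belowψσ≡ x) lem
    where
    lem : (fτ x <ᵇ ℓ) ≡ (countBelow τ x <ᵇ c + m₁)
    lem with suc (countBelow τ x) <? ℓ
    ... | yes r<ℓ rewrite nth-R-small (countBelow τ x) r<ℓ =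
      trans (<ᵇ≡true r<ℓ) (sym (<ᵇ≡true (≤-pred (subst (suc (countBelow τ x) <_) ℓ-eq r<ℓ))))
    ... | no r≮ℓ =
      trans (<ᵇ≡false (λ lt → r≮ℓ (≤-<-trans (nth-R-≥ (countBelow τ x) rank≤length-R) lt)))
            (sym (<ᵇ≡false (λ lt → r≮ℓ (subst (suc (countBelow τ x) <_) (sym ℓ-eq) (s≤s lt)))))
      where
      rank≤length-R : rank τ x ≤ length R
      rank≤length-R = ≤-trans (rank≤length τ xτ) length-τ≤length-R

  lmin-τ-gain : lminWith belowψσ [] τ ≡ suc (lminWith belowσ [] τ)
  lmin-τ-gain = trans (cong (lminWith belowψσ []) τ≡τ₁zτ₂)
    (trans (lminWith-gains-one belowσ belowψσ τ₁ z τ₂ hA pz qz az hC)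
    (cong (λ l → suc (lminWith belowσ [] l)) (sym τ≡τ₁zτ₂)))
    where
    hA : ∀ {x} → x ∈ τ₁ → belowσ x ≡ false × belowψσ x ≡ false
    hA m = trans (belowσ≡ _) (<ᵇ≡false (≤⇒≯ (τ₁-above-c m)))
      , trans (belowψσ-τ (∈τ₁⇒∈τ m)) (<ᵇ≡false (≤⇒≯ (countBelow-τ₁ m)))
    pz : belowσ z ≡ false
    pz = trans (belowσ≡ z) (<ᵇ≡false (≤⇒≯ (≤-trans c≤a (<⇒≤ a<z))))
    qz : belowψσ z ≡ true
    qz = trans (belowψσ-τ z∈τ) (<ᵇ≡true (≤-<-trans countBelow-τ-z (<-≤-trans (n∸1<n 1≤c) (m≤m+n c m₁))))
    az : all (λ y → z <ᵇ y) τ₁ ≡ true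
    az = all≡true _ τ₁ (λ {y} m → <ᵇ≡true (≤∧≢⇒< (z≤τ-above-c (∈τ₁⇒∈τ m) (τ₁-above-c m))
      (λ e → z∉τ₁ (subst (_∈ τ₁) (sym e) m))))
    hC : ∀ {x} → x ∈ τ₂ → belowσ x ≡ belowψσ x ⊎ z < x
    hC {x} m with x <? c
    ... | yes lt = inj₁ (trans (belowσ≡ x) (trans (<ᵇ≡true lt) (sym (trans (belowψσ-τ (∈τ₂⇒∈τ m))
                    (<ᵇ≡true (≤-<-trans (countBelow-τ-self (∈τ₂⇒∈τ m))
                      (≤-<-trans (m∸n≤m x 1) (<-≤-trans lt (m≤m+n c m₁)))))))))
    ... | no nl = inj₂ (≤∧≢⇒< (z≤τ-above-c (∈τ₂⇒∈τ m) (≮⇒≥ nl))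
      (λ e → z∉τ₂ (subst (_∈ τ₂) (sym e) m)))

  ψ≡ : ψ n π ≡ map fσ σ ++ n ∷ map fτ τ
  ψ≡ = trans (cong₂ (λ s t → stInv L (st s) ++ n ∷ stInv R (st t)) Psi-σ≡σ Psi-τ≡τ)
          (cong₂ (λ A B → A ++ n ∷ B) (sym (map-∘ σ)) (sym (map-∘ τ)))

  open AroundMaximum n σ τ fσ fτ fσ-preservesOrder fτ-preservesOrder fσ-bounds fτ-bounds

  lmin-ψ : lmin (map fσ σ ++ n ∷ map fτ τ) ≡ suc (lmin (σ ++ n ∷ τ))
  lmin-ψ = begin
    lmin (map fσ σ ++ n ∷ map fτ τ)      ≡⟨ lmin-image σ≢[] ⟩
    lminWith belowψσ [] τ + lmin σ       ≡⟨ cong (_+ lmin σ) lmin-τ-gain ⟩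
    suc (lminWith belowσ [] τ + lmin σ)  ≡⟨ cong suc (lmin-++-maximum n σ τ σ<n τ<n σ≢[]) ⟨
    suc (lmin (σ ++ n ∷ τ))              ∎
    where open ≡-Reasoning

  statistics : (lmax (ψ n π) ≡ lmax π) × (rmax (ψ n π) ≡ rmax π) × (asc (ψ n π) ≡ asc π) ×
    (ldr (ψ n π) ≡ ldr π) × (lir (ψ n π) ≡ lir π) × (lmin (ψ n π) ≡ suc (lmin π))
  statistics =
    tr lmax lmax-image ,
    tr rmax rmax-image ,
    tr asc (asc-sameUpDown sameUpDown) ,
    tr ldr (ldr-sameUpDown sameUpDown) ,
    tr lir (lir-sameUpDown sameUpDown) ,
    trans (cong lmin ψ≡) (trans lmin-ψ (cong (λ l → suc (lmin l)) (sym π≡σnτ)))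
    where
    tr : (f : List ℕ → ℕ) → f (map fσ σ ++ n ∷ map fτ τ) ≡ f (σ ++ n ∷ τ) → f (ψ n π) ≡ f π
    tr f e = trans (cong f ψ≡) (trans e (cong f (sym π≡σnτ)))

lemma6 : (n : ℕ) (π : List ℕ) → 2 ≤ n → IsPerm n π → Avoider π →
    head π ≢ just n →
    (Σ[ i ∈ Fin (length π) ] Σ[ j ∈ Fin (length π) ] (i <ᶠ j × π ! i ≡ n × π ! j ≡ n ∸ 1)) →
    (lmax (ψ n π) ≡ lmax π) × (rmax (ψ n π) ≡ rmax π) × (asc (ψ n π) ≡ asc π) ×
    (ldr (ψ n π) ≡ ldr π) × (lir (ψ n π) ≡ lir π) × (lmin (ψ n π) ≡ suc (lmin π))
lemma6 n π 2≤n perm (_ , avoids) head≢n (i , j , i<j , πi≡n , πj≡n-1) with split-at-index π i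
... | σ , τ , π≡σπiτ , after-i = Split.statistics n π σ τ 2≤n
    (permutationFacts n π perm) avoids π≡σnτ σ≢[] n-1∈τ
  where
  π≡σnτ : π ≡ σ ++ n ∷ τ
  π≡σnτ = subst (λ x → π ≡ σ ++ x ∷ τ) πi≡n π≡σπiτ
  n-1∈τ : n ∸ 1 ∈ τ
  n-1∈τ = subst (_∈ τ) πj≡n-1 (after-i j i<j)
  σ≢[] : σ ≢ []
  σ≢[] σ≡[] = head≢n (trans (cong head π≡σnτ) (cong (λ l → head (l ++ n ∷ τ)) σ≡[]))
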